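{- Let $k\ge2$, let $a_1,\ldots,a_k$ be positive integers and $c_1,\ldots,c_k$ integers. Consider the set of integer sequences $(\lambda_1,\ldots,\lambda_k)$ satisfying \[\lambda_1\ge c_1\left\lceil\frac{a_1}{a_2}\lambda_2\right\rceil+\sum_{i=2}^kc_i\lambda_i\quad\text{and}\quad \frac{\lambda_2}{a_2}\ge\frac{\lambda_3}{a_3}\ge\cdots\ge\frac{\lambda_k}{a_k}\ge0,\] and suppose the $c_i$ are such that every such sequence has $\lambda_1\ge0$. Then the generating function $\sum_\lambda q^{\lambda_1+\cdots+\lambda_k}$ of this set is \[\frac{\displaystyle\sum_{z_2=0}^{a_2-1}\cdots\sum_{z_k=0}^{a_k-1} q^{c_1\lceil a_1z_2/a_2\rceil+\sum_{i=2}^k(c_i+1)z_i}\prod_{i=2}^{k-1}q^{\,b_i\lceil z_{i+1}/a_{i+1}-z_i/a_i\rceil}}{\prod_{i=1}^k(1-q^{b_i})},\] where $b_1=1$ and $b_i=c_1a_1+(c_2+1)a_2+\cdots+(c_i+1)a_i$ for $2\le i\le k$. -}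

module Defs where

open import Data.Nat as ℕ using (ℕ; zero; suc; NonZero)
open import Data.Integer as ℤ using (ℤ; +_; _+_; _-_; _*_; _≤_)
open import Data.Rational as ℚ using (ℚ; ceiling)
open import Data.Fin using (Fin; zero; suc; inject₁; fromℕ; toℕ; inject≤)
open import Data.Vec using (Vec; []; _∷_; lookup)
open import Data.List using (List; length)
open import Data.List.Membership.Propositional using (_∈_)
open import Data.List.Relation.Unary.Unique.Propositional using (Unique)
open import Data.Product using (Σ; _×_; ∃)
open import Function.Bundles using (_⇔_)
open import Relation.Nullary using (yes; no)

∑ : (n : ℕ) → (Fin n → ℤ) → ℤ
∑ zero    f = + 0
∑ (suc n) f = f zero + ∑ n (λ i → f (suc i))

vsum : {n : ℕ} → Vec ℤ n → ℤ
vsum []       = + 0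
vsum (x ∷ xs) = x + vsum xs

sumRange : ℕ → (ℕ → ℤ) → ℤ
sumRange zero    f = + 0
sumRange (suc r) f = sumRange r f + f r

sumBox : (n : ℕ) → (Fin n → ℕ) → (Vec ℕ n → ℤ) → ℤ
sumBox zero    B f = f []
sumBox (suc n) B f = sumRange (B zero) (λ z → sumBox n (λ i → B (suc i)) (λ zs → f (z ∷ zs)))

δ : ℤ → ℤ → ℤ
δ x n with x ℤ.≟ n
... | yes _ = + 1
... | no  _ = + 0

HasCount : {A : Set} → (A → Set) → ℕ → Set
HasCount {A} P N = Σ (List A) λ L → Unique L × (∀ x → (x ∈ L) ⇔ P x) × (length L ≡ N)
  where open import Relation.Binary.PropositionalEquality using (_≡_)

-- Multiplication of a coefficient sequence G (coefficient of q^n is G n) by ∏_{i<n} (1 - q^{b i}).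
mulDen : (n : ℕ) → (Fin n → ℤ) → (ℤ → ℤ) → ℤ → ℤ
mulDen zero    b G = G
mulDen (suc n) b G = λ t → H t - H (t - b zero)
  where H = mulDen n (λ i → b (suc i)) G

-- Setting of Corollary 5 with k = 2 + m.  Index i : Fin k stands for the
-- paper's index i+1, i.e. zero ↦ 1, suc zero ↦ 2, ..., fromℕ (suc m) ↦ k.
module Setup (m : ℕ) (a : Fin (2 ℕ.+ m) → ℕ) (apos : ∀ i → NonZero (a i))
             (c : Fin (2 ℕ.+ m) → ℤ) where

  k : ℕ
  k = 2 ℕ.+ m

  _/a_ : ℤ → Fin k → ℚ
  x /a i = ℚ._/_ x (a i) {{apos i}}

  -- the paper's indices 2..k are suc j for j : Fin (1 ℕ.+ m)
  -- conditions on λ = (λ_1, ..., λ_k)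
  Cond : Vec ℤ k → Set
  Cond v =
      (c zero * ceiling ((ℚ._*_ ((+ a zero) /a suc zero) (v₂ ℚ./ 1)))
         + ∑ (1 ℕ.+ m) (λ j → c (suc j) * lookup v (suc j))  ≤  lookup v zero)
    × (∀ (j : Fin m) → ((lookup v (suc (suc j))) /a (suc (suc j)))
                          ℚ.≤ ((lookup v (suc (inject₁ j))) /a (suc (inject₁ j))))
    × (ℚ.0ℚ ℚ.≤ (lookup v (fromℕ (suc m)) /a fromℕ (suc m)))
    where v₂ = lookup v (suc zero)

  Sol : ℤ → Vec ℤ k → Set
  Sol n v = Cond v × (vsum v ≡ n)
    where open import Relation.Binary.PropositionalEquality using (_≡_)

  b : Fin k → ℤ
  b zero    = + 1
  b (suc j) = c zero * + a zero + ∑ (suc (toℕ j))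
                 (λ t → (c (suc (inject≤ t (s≤ j))) + + 1) * + a (suc (inject≤ t (s≤ j))))
    where
    open import Data.Fin.Properties using (toℕ<n)
    s≤ : (j : Fin (1 ℕ.+ m)) → suc (toℕ j) ℕ.≤ 1 ℕ.+ m
    s≤ j = toℕ<n j

  -- exponent of the numerator term indexed by (z_2, ..., z_k), z_{j+2} = lookup z j
  expo : Vec ℕ (1 ℕ.+ m) → ℤ
  expo z =
      c zero * ceiling ((+ (a zero ℕ.* lookup z zero)) /a suc zero)
    + ∑ (1 ℕ.+ m) (λ j → (c (suc j) + + 1) * + lookup z j)
    + ∑ m (λ j → b (suc (inject₁ j)) *
           ceiling (ℚ._-_ ((+ lookup z (suc j)) /a suc (suc j))
                          ((+ lookup z (inject₁ j)) /a suc (inject₁ j))))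

  -- coefficient of q^n in the numerator polynomial
  numer : ℤ → ℤ
  numer n = sumBox (1 ℕ.+ m) (λ j → a (suc j)) (λ z → δ (expo z) n)

-- Write λ_i = a_i t_i + z_i with 0 ≤ z_i < a_i for i ≥ 2. Cross-multiplied, λ_{i+1}/a_{i+1} ≤ λ_i/a_i
-- becomes t_i ≥ t_{i+1} + ⌈z_{i+1}/a_{i+1} − z_i/a_i⌉, a ceiling that is 0 or 1. So the solutions
-- correspond bijectively to a residue vector z together with k free natural numbers: the excess of λ_1
-- over its lower bound, the slacks t_i − t_{i+1} − ⌈…⌉ for i < k, and t_k. Under this correspondence
-- λ_1 + ⋯ + λ_k is the numerator exponent of z plus Σ b_i·(i-th free number). The hypothesis λ_1 ≥ 0,
-- applied to z = 0 with a single unit slack, forces b_i ≥ 1; so for fixed z the free numbers are counted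
-- by partitions into parts b_1, …, b_k, whose generating function is 1/∏(1 − q^{b_i}).

module Submission where

open import Defs
import Data.Nat
import Data.Fin
import Data.Integer


module Counting where

  open import Data.Nat using (ℕ; _+_)
  open import Data.List using ([]; _∷_; _++_; map)
  open import Data.List.Properties using (length-++; length-map)
  open import Data.List.Membership.Propositional.Properties using (∈-++⁺ˡ; ∈-++⁺ʳ; ∈-++⁻; ∈-map⁺; ∈-map⁻)
  open import Data.List.Relation.Unary.Any using (here; there)
  open import Data.List.Relation.Unary.All as All using (All; []; _∷_)
  open import Data.List.Relation.Unary.AllPairs using (_∷_; [])
  open import Data.List.Relation.Unary.Unique.Propositional using (Unique)
  open import Data.List.Relation.Unary.Unique.Propositional.Properties using (++⁺)
  open import Data.Product using (∃; _×_; _,_)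
  open import Data.Sum as Sum using (_⊎_; [_,_])
  open import Data.Empty using (⊥-elim)
  open import Function using (_∘_)
  open import Data.List.Membership.Propositional using (_∈_)
  open import Function.Bundles using (_⇔_; mk⇔; Equivalence)
  open import Relation.Nullary using (¬_)
  open import Relation.Binary.PropositionalEquality using (_≡_; _≢_; refl; sym; trans; cong₂; subst)
  open Equivalence

  private variable
    A B : Set
    P Q : A → Set
    M N : ℕ

  HasCount-resp : (∀ x → P x ⇔ Q x) → HasCount P N → HasCount Q N
  HasCount-resp P⇔Q (L , unique , mem , len) =
    L , unique , (λ x → mk⇔ (to (P⇔Q x) ∘ to (mem x)) (from (mem x) ∘ from (P⇔Q x))) , len

  HasCount-empty : (∀ x → ¬ P x) → HasCount P 0
  HasCount-empty ¬P = [] , [] , (λ x → mk⇔ (λ ()) (λ p → ⊥-elim (¬P x p))) , refl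

  HasCount-≡ : (a : A) → HasCount (_≡ a) 1
  HasCount-≡ a = a ∷ [] , [] ∷ [] , (λ x → mk⇔ (λ { (here x≡a) → x≡a ; (there ()) }) here) , refl

  HasCount-⊎ : HasCount P N → HasCount Q M → (∀ x → P x → ¬ Q x) → HasCount (λ x → P x ⊎ Q x) (N + M)
  HasCount-⊎ (L , uL , memL , lenL) (K , uK , memK , lenK) disjoint =
    L ++ K ,
    ++⁺ uL uK (λ (x∈L , x∈K) → disjoint _ (to (memL _) x∈L) (to (memK _) x∈K)) ,
    (λ x → mk⇔ (Sum.map (to (memL x)) (to (memK x)) ∘ ∈-++⁻ L)
               [ ∈-++⁺ˡ ∘ from (memL x) , ∈-++⁺ʳ L ∘ from (memK x) ]) ,
    trans (length-++ L) (cong₂ _+_ lenL lenK)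

  private
    map-unique : (f : A → B) → (∀ {x y} → P x → P y → f x ≡ f y → x ≡ y) →
                 ∀ {L} → All P L → Unique L → Unique (map f L)
    map-unique f inj [] [] = []
    map-unique {P = P} f inj (px ∷ pL) (x∉L ∷ uL) = apart px pL x∉L ∷ map-unique f inj pL uL
      where
      apart : ∀ {x L} → P x → All P L → All (x ≢_) L → All (f x ≢_) (map f L)
      apart px [] [] = []
      apart px (py ∷ pL) (x≢y ∷ x∉L) = (λ fx≡fy → x≢y (inj px py fx≡fy)) ∷ apart px pL x∉L

  HasCount-image : (f : A → B) → HasCount P N → (∀ {x y} → P x → P y → f x ≡ f y → x ≡ y) →
                   HasCount (λ y → ∃ λ x → P x × f x ≡ y) N
  HasCount-image f (L , uL , mem , len) inj =
    map f L ,
    map-unique f inj (All.tabulate (to (mem _))) uL ,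
    (λ y → mk⇔ (λ y∈ → let (x , x∈L , y≡fx) = ∈-map⁻ f y∈ in x , to (mem x) x∈L , sym y≡fx)
               (λ (x , px , fx≡y) → subst (_∈ map f L) fx≡y (∈-map⁺ f (from (mem x) px)))) ,
    trans (length-map f L) len


module Partitions where

  open Counting
  open import Data.Nat using (ℕ; zero; suc; _+_; _*_; _∸_; _≤_; _<_; _≤?_; s≤s; z≤n)
  open import Data.Nat.Properties
    using (*-suc; *-zeroʳ; +-assoc; m≤m+n; m+n∸m≡n; m+[n∸m]≡n; ∸-monoʳ-<; <-≤-trans; ≤-refl)
  open import Data.Fin using (Fin; zero; suc)
  open import Data.Vec using (Vec; []; _∷_)
  open import Data.Vec.Properties using (∷-injectiveʳ)
  open import Data.Product using (∃; _×_; _,_)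
  open import Data.Sum using (_⊎_; inj₁; inj₂; [_,_])
  open import Function using (_∘_)
  open import Function.Bundles using (_⇔_; mk⇔)
  open import Relation.Nullary using (yes; no; ¬_; contradiction)
  open import Relation.Binary.PropositionalEquality using (_≡_; refl; sym; trans; cong; subst)

  -- Part sizes are written 1 + d i, so that they are positive by construction.
  weight : (n : ℕ) → (Fin n → ℕ) → Vec ℕ n → ℕ
  weight zero    d []       = 0
  weight (suc n) d (x ∷ xs) = suc (d zero) * x + weight n (d ∘ suc) xs

  mutual
    reps : (n : ℕ) → (Fin n → ℕ) → ℕ → ℕ
    reps zero    d zero    = 1
    reps zero    d (suc t) = 0
    reps (suc n) d t       = repsFuel n d (suc t) t

    -- repsFuel n d f t counts the solutions whose first coordinate is below f; f = 1 + t counts all.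
    repsFuel : (n : ℕ) → (Fin (suc n) → ℕ) → ℕ → ℕ → ℕ
    repsFuel n d zero    t = 0
    repsFuel n d (suc f) t with suc (d zero) ≤? t
    ... | yes _ = reps n (d ∘ suc) t + repsFuel n d f (t ∸ suc (d zero))
    ... | no  _ = reps n (d ∘ suc) t

  module _ (n : ℕ) (d : Fin (suc n) → ℕ) where

    incHead : Vec ℕ (suc n) → Vec ℕ (suc n)
    incHead (x ∷ xs) = suc x ∷ xs

    incHead-injective : ∀ {u v} → incHead u ≡ incHead v → u ≡ v
    incHead-injective {_ ∷ _} {_ ∷ _} refl = refl

    weight-zeroHead : ∀ xs → weight (suc n) d (0 ∷ xs) ≡ weight n (d ∘ suc) xs
    weight-zeroHead xs = cong (_+ weight n (d ∘ suc) xs) (*-zeroʳ (suc (d zero)))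

    weight-incHead : ∀ u → weight (suc n) d (incHead u) ≡ suc (d zero) + weight (suc n) d u
    weight-incHead (x ∷ xs) =
      trans (cong (_+ weight n (d ∘ suc) xs) (*-suc (suc (d zero)) x)) (+-assoc (suc (d zero)) _ _)

    ZeroHead SucHead : ℕ → Vec ℕ (suc n) → Set
    ZeroHead t u = ∃ λ xs → weight n (d ∘ suc) xs ≡ t × 0 ∷ xs ≡ u
    SucHead  t u = ∃ λ v → weight (suc n) d v ≡ t × incHead v ≡ u

    split-by-head : ∀ {t} u → weight (suc n) d u ≡ t → ZeroHead t u ⊎ SucHead (t ∸ suc (d zero)) u
    split-by-head (zero  ∷ xs) refl = inj₁ (xs , sym (weight-zeroHead xs) , refl)
    split-by-head (suc x ∷ xs) refl =
      inj₂ (x ∷ xs , sym (trans (cong (_∸ suc (d zero)) (weight-incHead (x ∷ xs))) (m+n∸m≡n (suc (d zero)) _)) , refl)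

    weight-ZeroHead : ∀ {t u} → ZeroHead t u → weight (suc n) d u ≡ t
    weight-ZeroHead (xs , w≡t , refl) = trans (weight-zeroHead xs) w≡t

    weight-SucHead : ∀ {t u} → suc (d zero) ≤ t → SucHead (t ∸ suc (d zero)) u → weight (suc n) d u ≡ t
    weight-SucHead b≤t (v , w≡t∸b , refl) =
      trans (weight-incHead v) (trans (cong (suc (d zero) +_) w≡t∸b) (m+[n∸m]≡n b≤t))

    ≤-weight-SucHead : ∀ {t u} → SucHead t u → suc (d zero) ≤ weight (suc n) d u
    ≤-weight-SucHead (v , _ , refl) = subst (suc (d zero) ≤_) (sym (weight-incHead v)) (m≤m+n _ _)

  mutual
    HasCount-reps : ∀ n d t → HasCount (λ u → weight n d u ≡ t) (reps n d t)
    HasCount-reps zero    d zero    = HasCount-resp (λ { [] → mk⇔ (λ _ → refl) (λ _ → refl) }) (HasCount-≡ [])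
    HasCount-reps zero    d (suc t) = HasCount-empty (λ { [] () })
    HasCount-reps (suc n) d t       = HasCount-repsFuel n d (suc t) t ≤-refl

    HasCount-repsFuel : ∀ n d f t → t < f → HasCount (λ u → weight (suc n) d u ≡ t) (repsFuel n d f t)
    HasCount-repsFuel n d (suc f) t (s≤s t≤f) with suc (d zero) ≤? t
    ... | yes b≤t = HasCount-resp (λ u → mk⇔ [ weight-ZeroHead n d , weight-SucHead n d b≤t ] (split-by-head n d u))
                      (HasCount-⊎ (HasCount-ZeroHead n d t) sucHeads (λ { u (_ , _ , refl) (_ ∷ _ , _ , ()) }))
      where
      sucHeads : HasCount (SucHead n d (t ∸ suc (d zero))) (repsFuel n d f (t ∸ suc (d zero)))
      sucHeads = HasCount-image (incHead n d)
                   (HasCount-repsFuel n d f _ (<-≤-trans (∸-monoʳ-< (s≤s z≤n) b≤t) t≤f))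
                   (λ _ _ → incHead-injective n d)
    ... | no b≰t = HasCount-resp (λ u → mk⇔ (weight-ZeroHead n d) (onlyZeroHead u)) (HasCount-ZeroHead n d t)
      where
      onlyZeroHead : ∀ u → weight (suc n) d u ≡ t → ZeroHead n d t u
      onlyZeroHead u w≡t with split-by-head n d u w≡t
      ... | inj₁ zh = zh
      ... | inj₂ sh = contradiction (subst (suc (d zero) ≤_) w≡t (≤-weight-SucHead n d sh)) b≰t

    HasCount-ZeroHead : ∀ n d t → HasCount (ZeroHead n d t) (reps n (d ∘ suc) t)
    HasCount-ZeroHead n d t = HasCount-image (0 ∷_) (HasCount-reps n (d ∘ suc) t) (λ _ _ → ∷-injectiveʳ)

  repsFuel-irrelevant : ∀ n d f g t → t < f → t < g → repsFuel n d f t ≡ repsFuel n d g t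
  repsFuel-irrelevant n d (suc f) (suc g) t (s≤s t≤f) (s≤s t≤g) with suc (d zero) ≤? t
  ... | yes b≤t = cong (reps n (d ∘ suc) t +_)
                    (repsFuel-irrelevant n d f g _ (<-≤-trans t∸b<t t≤f) (<-≤-trans t∸b<t t≤g))
    where t∸b<t = ∸-monoʳ-< (s≤s z≤n) b≤t
  ... | no  _   = refl

  reps-≥ : ∀ n d t → suc (d zero) ≤ t → reps (suc n) d t ≡ reps n (d ∘ suc) t + reps (suc n) d (t ∸ suc (d zero))
  reps-≥ n d t b≤t with suc (d zero) ≤? t
  ... | yes _   = cong (reps n (d ∘ suc) t +_) (repsFuel-irrelevant n d t _ _ (∸-monoʳ-< (s≤s z≤n) b≤t) ≤-refl)
  ... | no  b≰t = contradiction b≤t b≰t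

  reps-< : ∀ n d t → ¬ suc (d zero) ≤ t → reps (suc n) d t ≡ reps n (d ∘ suc) t
  reps-< n d t b≰t with suc (d zero) ≤? t
  ... | yes b≤t = contradiction b≤t b≰t
  ... | no  _   = refl


module Series where

  open Counting
  open Partitions
  open import Data.Nat as ℕ using (ℕ; zero; suc)
  import Data.Nat.Properties as ℕ
  open import Data.Integer using (ℤ; +_; -[1+_]; _+_; _-_; -_; _≟_)
  import Data.Integer.Properties as ℤ
  open import Data.Integer.Tactic.RingSolver using (solve-∀)
  open import Data.Fin using (Fin; zero; suc)
  open import Data.Vec using (Vec; []; _∷_)
  open import Function using (_∘_)
  open import Function.Bundles using (mk⇔)
  open import Relation.Nullary using (Dec; yes; no; contradiction)
  open import Relation.Binary.PropositionalEquality
    using (_≡_; refl; sym; trans; cong; cong₂; module ≡-Reasoning)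

  private
    x+y-y≡x : ∀ x y → x + y - y ≡ x
    x+y-y≡x = solve-∀
    a+b-[c+d]≡[a-c]+[b-d] : ∀ a b c d → (a + b) - (c + d) ≡ (a - c) + (b - d)
    a+b-[c+d]≡[a-c]+[b-d] = solve-∀
    a-b-[c-d]≡a-c-[b-d] : ∀ a b c d → (a - b) - (c - d) ≡ (a - c) - (b - d)
    a-b-[c-d]≡a-c-[b-d] = solve-∀
    x-y-z≡x-z-y : ∀ x y z → x - y - z ≡ x - z - y
    x-y-z≡x-z-y = solve-∀

  repsℤ : (n : ℕ) → (Fin n → ℕ) → ℤ → ℕ
  repsℤ n d (+ t)    = reps n d t
  repsℤ n d -[1+ _ ] = 0

  HasCount-repsℤ : ∀ n d x → HasCount (λ u → + weight n d u ≡ x) (repsℤ n d x)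
  HasCount-repsℤ n d (+ t)    = HasCount-resp (λ u → mk⇔ (cong (λ k → + k)) ℤ.+-injective) (HasCount-reps n d t)
  HasCount-repsℤ n d -[1+ _ ] = HasCount-empty (λ u ())

  repsℤ-step : ∀ n d x → + repsℤ (suc n) d x - + repsℤ (suc n) d (x - + suc (d zero)) ≡ + repsℤ n (d ∘ suc) x
  repsℤ-step n d -[1+ _ ] = refl
  repsℤ-step n d (+ t) = step (b ℕ.≤? t)
    where
    open ≡-Reasoning
    b = suc (d zero)
    R = reps n (d ∘ suc) t
    step : Dec (b ℕ.≤ t) → + reps (suc n) d t - + repsℤ (suc n) d (+ t - + b) ≡ + R
    step (yes b≤t) = begin
      + reps (suc n) d t - + repsℤ (suc n) d (+ t - + b)  ≡⟨ cong (λ x → + reps (suc n) d t - + repsℤ (suc n) d x) t-b≡t∸b ⟩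
      + reps (suc n) d t - + S                            ≡⟨ cong (λ k → + k - + S) (reps-≥ n d t b≤t) ⟩
      + (R ℕ.+ S) - + S                                   ≡⟨ cong (_- + S) (ℤ.pos-+ R S) ⟩
      + R + + S - + S                                     ≡⟨ x+y-y≡x (+ R) (+ S) ⟩
      + R ∎
      where
      S = reps (suc n) d (t ℕ.∸ b)
      t-b≡t∸b : + t - + b ≡ + (t ℕ.∸ b)
      t-b≡t∸b = trans (ℤ.m-n≡m⊖n t b) (ℤ.⊖-≥ b≤t)
    step (no b≰t) = begin
      + reps (suc n) d t - + repsℤ (suc n) d (+ t - + b)  ≡⟨ cong (λ x → + reps (suc n) d t - + repsℤ (suc n) d x) t-b<0 ⟩
      + reps (suc n) d t - + 0                            ≡⟨ ℤ.+-identityʳ _ ⟩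
      + reps (suc n) d t                                  ≡⟨ cong (λ k → + k) (reps-< n d t b≰t) ⟩
      + R ∎
      where
      t-b<0 : + t - + b ≡ -[1+ d zero ℕ.∸ t ]
      t-b<0 = trans (ℤ.m-n≡m⊖n t b)
                    (trans (ℤ.⊖-< (ℕ.≰⇒> b≰t)) (cong (λ k → - + k) (ℕ.+-∸-assoc 1 (ℕ.≤-pred (ℕ.≰⇒> b≰t)))))

  mulDen-cong : ∀ n b G H → (∀ t → G t ≡ H t) → ∀ t → mulDen n b G t ≡ mulDen n b H t
  mulDen-cong zero    b G H G≗H t = G≗H t
  mulDen-cong (suc n) b G H G≗H t =
    cong₂ _-_ (mulDen-cong n (b ∘ suc) G H G≗H t) (mulDen-cong n (b ∘ suc) G H G≗H (t - b zero))

  mulDen-cong-parts : ∀ n b c G → (∀ i → b i ≡ c i) → ∀ t → mulDen n b G t ≡ mulDen n c G t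
  mulDen-cong-parts zero    b c G b≗c t = refl
  mulDen-cong-parts (suc n) b c G b≗c t =
    cong₂ _-_ (mulDen-cong-parts n (b ∘ suc) (c ∘ suc) G (b≗c ∘ suc) t)
              (trans (cong (λ s → mulDen n (b ∘ suc) G (t - s)) (b≗c zero))
                     (mulDen-cong-parts n (b ∘ suc) (c ∘ suc) G (b≗c ∘ suc) _))

  mulDen-+ : ∀ n b G H t → mulDen n b (λ s → G s + H s) t ≡ mulDen n b G t + mulDen n b H t
  mulDen-+ zero    b G H t = refl
  mulDen-+ (suc n) b G H t =
    trans (cong₂ _-_ (mulDen-+ n (b ∘ suc) G H t) (mulDen-+ n (b ∘ suc) G H (t - b zero)))
          (a+b-[c+d]≡[a-c]+[b-d] (mulDen n (b ∘ suc) G t) (mulDen n (b ∘ suc) H t) _ _)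

  mulDen-zero : ∀ n b t → mulDen n b (λ _ → + 0) t ≡ + 0
  mulDen-zero zero    b t = refl
  mulDen-zero (suc n) b t = cong₂ _-_ (mulDen-zero n (b ∘ suc) t) (mulDen-zero n (b ∘ suc) (t - b zero))

  mulDen-difference : ∀ n b G e t → mulDen n b (λ s → G s - G (s - e)) t ≡ mulDen n b G t - mulDen n b G (t - e)
  mulDen-difference zero    b G e t = refl
  mulDen-difference (suc n) b G e t =
    trans (cong₂ _-_ (mulDen-difference n (b ∘ suc) G e t) (mulDen-difference n (b ∘ suc) G e (t - b zero)))
          (trans (cong (λ s → (H t - H (t - e)) - (H (t - b zero) - H s)) (x-y-z≡x-z-y t (b zero) e))
                 (a-b-[c-d]≡a-c-[b-d] (H t) (H (t - e)) (H (t - b zero)) _))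
    where H = mulDen n (b ∘ suc) G

  sumRange-cong : ∀ r f g → (∀ z → f z ≡ g z) → sumRange r f ≡ sumRange r g
  sumRange-cong zero    f g f≗g = refl
  sumRange-cong (suc r) f g f≗g = cong₂ _+_ (sumRange-cong r f g f≗g) (f≗g r)

  sumBox-cong : ∀ p B f g → (∀ z → f z ≡ g z) → sumBox p B f ≡ sumBox p B g
  sumBox-cong zero    B f g f≗g = f≗g []
  sumBox-cong (suc p) B f g f≗g =
    sumRange-cong (B zero) _ _ (λ z → sumBox-cong p (B ∘ suc) _ _ (λ zs → f≗g (z ∷ zs)))

  mulDen-sumRange : ∀ n b r (G : ℕ → ℤ → ℤ) t →
                    mulDen n b (λ s → sumRange r (λ z → G z s)) t ≡ sumRange r (λ z → mulDen n b (G z) t)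
  mulDen-sumRange n b zero    G t = mulDen-zero n b t
  mulDen-sumRange n b (suc r) G t =
    trans (mulDen-+ n b (λ s → sumRange r (λ z → G z s)) (G r) t)
          (cong (_+ mulDen n b (G r) t) (mulDen-sumRange n b r G t))

  mulDen-sumBox : ∀ n b p B (G : Vec ℕ p → ℤ → ℤ) t →
                  mulDen n b (λ s → sumBox p B (λ z → G z s)) t ≡ sumBox p B (λ z → mulDen n b (G z) t)
  mulDen-sumBox n b zero    B G t = refl
  mulDen-sumBox n b (suc p) B G t =
    trans (mulDen-sumRange n b (B zero) (λ z s → sumBox p (B ∘ suc) (λ zs → G (z ∷ zs) s)) t)
          (sumRange-cong (B zero) _ _ (λ z → mulDen-sumBox n b p (B ∘ suc) (G ∘ (z ∷_)) t))

  mulDen-repsℤ : ∀ n d e t → mulDen n (λ i → + suc (d i)) (λ s → + repsℤ n d (s - e)) t ≡ δ e t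
  mulDen-repsℤ zero d e t with e ≟ t
  ... | yes refl = cong (λ x → + repsℤ 0 d x) (ℤ.+-inverseʳ t)
  ... | no e≢t with t - e in t-e≡
  ...   | + zero   = contradiction (sym (ℤ.i-j≡0⇒i≡j t e t-e≡)) e≢t
  ...   | + suc _  = refl
  ...   | -[1+ _ ] = refl
  mulDen-repsℤ (suc n) d e t = begin
    mulDen n b′ G t - mulDen n b′ G (t - b)  ≡⟨ mulDen-difference n b′ G b t ⟨
    mulDen n b′ (λ s → G s - G (s - b)) t    ≡⟨ mulDen-cong n b′ _ _ telescope t ⟩
    mulDen n b′ (λ s → + repsℤ n (d ∘ suc) (s - e)) t ≡⟨ mulDen-repsℤ n (d ∘ suc) e t ⟩
    δ e t ∎
    where
    open ≡-Reasoning
    b = + suc (d zero)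
    b′ = λ (i : Fin n) → + suc (d (suc i))
    G = λ s → + repsℤ (suc n) d (s - e)
    telescope : ∀ s → G s - G (s - b) ≡ + repsℤ n (d ∘ suc) (s - e)
    telescope s = trans (cong (λ x → G s - + repsℤ (suc n) d x) (x-y-z≡x-z-y s b e)) (repsℤ-step n d (s - e))


module Boxes where

  open Counting
  open Series using (sumRange-cong)
  open import Data.Nat using (ℕ; zero; suc; _+_; _<_)
  open import Data.Nat.Properties using (<-irrefl; m<n⇒m<1+n; m≤n⇒m<n∨m≡n; ≤-pred; ≤-refl)
  open import Data.Integer as ℤ using (ℤ; +_)
  import Data.Integer.Properties as ℤ
  open import Data.Fin using (Fin; zero; suc)
  open import Data.Vec using (Vec; []; _∷_)
  open import Data.Product using (∃; _×_; _,_; proj₁; proj₂)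
  open import Data.Sum using (_⊎_; inj₁; inj₂)
  open import Data.Unit using (⊤; tt)
  open import Relation.Nullary using (¬_)
  open import Function using (_∘_)
  open import Function.Bundles using (_⇔_; mk⇔)
  open import Relation.Binary.PropositionalEquality using (_≡_; refl; trans; cong; cong₂)

  Box : (p : ℕ) → (Fin p → ℕ) → Vec ℕ p → Set
  Box zero    B []       = ⊤
  Box (suc p) B (z ∷ zs) = z < B zero × Box p (B ∘ suc) zs

  InBox : ∀ p → (Fin p → ℕ) → {X : Set} → (Vec ℕ p → X → Set) → Vec ℕ p × X → Set
  InBox p B Q (z , x) = Box p B z × Q z x

  sumRangeℕ : ℕ → (ℕ → ℕ) → ℕ
  sumRangeℕ zero    f = 0
  sumRangeℕ (suc r) f = sumRangeℕ r f + f r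

  sumBoxℕ : (p : ℕ) → (Fin p → ℕ) → (Vec ℕ p → ℕ) → ℕ
  sumBoxℕ zero    B N = N []
  sumBoxℕ (suc p) B N = sumRangeℕ (B zero) (λ z → sumBoxℕ p (B ∘ suc) (N ∘ (z ∷_)))

  sumBoxℕ-sumBox : ∀ p B N → + sumBoxℕ p B N ≡ sumBox p B (λ z → + N z)
  sumBoxℕ-sumBox zero    B N = refl
  sumBoxℕ-sumBox (suc p) B N = sumRange-sumRangeℕ (B zero)
    where
    sumRange-sumRangeℕ : ∀ r → + sumRangeℕ r (λ z → sumBoxℕ p (B ∘ suc) (N ∘ (z ∷_)))
                               ≡ sumRange r (λ z → sumBox p (B ∘ suc) (λ zs → + N (z ∷ zs)))
    sumRange-sumRangeℕ zero    = refl
    sumRange-sumRangeℕ (suc r) =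
      trans (ℤ.pos-+ (sumRangeℕ r (λ z → sumBoxℕ p (B ∘ suc) (N ∘ (z ∷_)))) _)
            (cong₂ ℤ._+_ (sumRange-sumRangeℕ r) (sumBoxℕ-sumBox p (B ∘ suc) (N ∘ (r ∷_))))

  HasCount-box : ∀ p B {X : Set} (Q : Vec ℕ p → X → Set) (N : Vec ℕ p → ℕ) →
                 (∀ z → HasCount (Q z) (N z)) → HasCount (InBox p B Q) (sumBoxℕ p B N)
  HasCount-box zero B {X} Q N count =
    HasCount-resp bundle (HasCount-image ([] ,_) (count []) (λ { _ _ refl → refl }))
    where
    bundle : ∀ y → (∃ λ x → Q [] x × ([] , x) ≡ y) ⇔ InBox 0 B Q y
    bundle ([] , x) = mk⇔ (λ { (x , q , refl) → tt , q }) (λ (_ , q) → x , q , refl)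
  HasCount-box (suc p) B {X} Q N count = HasCount-resp atBound (headBelow (B zero))
    where
    Q′ : ℕ → Vec ℕ p → X → Set
    Q′ z zs = Q (z ∷ zs)
    M : ℕ → ℕ
    M z = sumBoxℕ p (B ∘ suc) (N ∘ (z ∷_))
    HeadBelow : ℕ → Vec ℕ (suc p) × X → Set
    HeadBelow r (z ∷ zs , x) = z < r × InBox p (B ∘ suc) (Q′ z) (zs , x)
    atBound : ∀ y → HeadBelow (B zero) y ⇔ InBox (suc p) B Q y
    atBound (z ∷ zs , x) = mk⇔ (λ (z< , bx , q) → (z< , bx) , q) (λ ((z< , bx) , q) → z< , bx , q)
    HeadIs : ℕ → Vec ℕ (suc p) × X → Set
    HeadIs r y = ∃ λ w → InBox p (B ∘ suc) (Q′ r) w × (r ∷ proj₁ w , proj₂ w) ≡ y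
    headBelow : ∀ r → HasCount (HeadBelow r) (sumRangeℕ r M)
    headBelow zero    = HasCount-empty (λ { (_ ∷ _ , _) (() , _) })
    headBelow (suc r) = HasCount-resp split (HasCount-⊎ (headBelow r) headIs disjoint)
      where
      headIs : HasCount (HeadIs r) (M r)
      headIs = HasCount-image _ (HasCount-box p (B ∘ suc) (Q′ r) (N ∘ (r ∷_)) (count ∘ (r ∷_)))
                 (λ { {_ , _} {_ , _} _ _ refl → refl })
      disjoint : ∀ y → HeadBelow r y → ¬ HeadIs r y
      disjoint (z ∷ zs , x) (z<r , _) (_ , _ , refl) = <-irrefl refl z<r
      split : ∀ y → (HeadBelow r y ⊎ HeadIs r y) ⇔ HeadBelow (suc r) y
      split (z ∷ zs , x) = mk⇔ fw bw
        where
        fw : HeadBelow r (z ∷ zs , x) ⊎ HeadIs r (z ∷ zs , x) → HeadBelow (suc r) (z ∷ zs , x)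
        fw (inj₁ (z<r , inBox))      = m<n⇒m<1+n z<r , inBox
        fw (inj₂ (_ , inBox , refl)) = ≤-refl , inBox
        bw : HeadBelow (suc r) (z ∷ zs , x) → HeadBelow r (z ∷ zs , x) ⊎ HeadIs r (z ∷ zs , x)
        bw (z<1+r , inBox) with m≤n⇒m<n∨m≡n (≤-pred z<1+r)
        ... | inj₁ z<r  = inj₁ (z<r , inBox)
        ... | inj₂ refl = inj₂ ((zs , x) , inBox , refl)


module Ratios where

  open import Data.Nat as ℕ using (ℕ; suc; NonZero)
  import Data.Nat.Properties as ℕ
  open import Data.Integer as ℤ using (ℤ; +_; _+_; _-_; _*_; -_; _≤_; _<_)
  import Data.Integer.Properties as ℤ
  import Data.Integer.DivMod as ℤ
  open import Data.Integer.GCD using (gcd)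
  open import Data.Integer.Tactic.RingSolver using (solve-∀)
  open import Data.Rational as ℚ using (ℚ; mkℚ; ↥_; ↧_; ↧ₙ_; ceiling; floor; *≤*)
  import Data.Rational.Properties as ℚ
  open import Data.Product using (Σ; _×_; _,_)
  open import Function.Bundles using (_⇔_; mk⇔)
  open import Relation.Binary.PropositionalEquality
    using (_≡_; sym; trans; cong; cong₂; subst; subst₂; module ≡-Reasoning)

  ≤-of-≡+ : ∀ {i j} k → j ≡ i + + k → i ≤ j
  ≤-of-≡+ {i} k j≡i+k = subst (i ≤_) (sym j≡i+k) (ℤ.i≤i+j i (+ k))

  <-of-≡+suc : ∀ {i j} k → j ≡ i + + suc k → i < j
  <-of-≡+suc {i} k j≡i+1+k = ℤ.suc[i]≤j⇒i<j (≤-of-≡+ k (trans j≡i+1+k (1+k≡ i)))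
    where
    1+k≡ : ∀ i → i + + suc k ≡ ℤ.suc i + + k
    1+k≡ i = trans (sym (ℤ.+-assoc i (+ 1) (+ k))) (cong (_+ + k) (ℤ.+-comm i (+ 1)))

  -- p = x / A, with x / A not necessarily in lowest terms
  IsRatio : ℚ → ℤ → ℕ → Set
  IsRatio p x A = ↥ p * + A ≡ x * ↧ p

  isRatio-/ : ∀ x A .{{_ : NonZero A}} → IsRatio (x ℚ./ A) x A
  isRatio-/ x A = begin
    ↥ r * + A        ≡⟨ cong (↥ r *_) (ℚ.↧-/ x A) ⟨
    ↥ r * (↧ r * g)  ≡⟨ a[bc]≡[ac]b (↥ r) (↧ r) g ⟩
    (↥ r * g) * ↧ r  ≡⟨ cong (_* ↧ r) (ℚ.↥-/ x A) ⟩
    x * ↧ r ∎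
    where
    open ≡-Reasoning
    r = x ℚ./ A
    g = gcd x (+ A)
    a[bc]≡[ac]b : ∀ a b c → a * (b * c) ≡ (a * c) * b
    a[bc]≡[ac]b = solve-∀

  isRatio-* : ∀ p q x y A B .{{_ : NonZero A}} .{{_ : NonZero B}} →
              IsRatio p x A → IsRatio q y B → IsRatio (p ℚ.* q) (x * y) (A ℕ.* B)
  isRatio-* p@(mkℚ n d _) q@(mkℚ m e _) x y A B p≐ q≐ = ℤ.*-cancelʳ-≡ _ _ (+ suc d * + suc e) (begin
    ↥ r * + (A ℕ.* B) * (+ suc d * + suc e) ≡⟨ cong (λ z → ↥ r * z * (+ suc d * + suc e)) (ℤ.pos-* A B) ⟩
    ↥ r * (+ A * + B) * (+ suc d * + suc e) ≡⟨ l1 (↥ r) (+ A) (+ B) (+ suc d) (+ suc e) ⟩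
    (↥ r * + (suc d ℕ.* suc e)) * + A * + B ≡⟨ cong (λ z → z * + A * + B) (isRatio-/ (n * m) (suc d ℕ.* suc e)) ⟩
    (n * m * ↧ r) * + A * + B               ≡⟨ l2 n m (↧ r) (+ A) (+ B) ⟩
    (n * + A) * (m * + B) * ↧ r             ≡⟨ cong₂ (λ u v → u * v * ↧ r) p≐ q≐ ⟩
    (x * + suc d) * (y * + suc e) * ↧ r     ≡⟨ l3 x y (+ suc d) (+ suc e) (↧ r) ⟩
    x * y * ↧ r * (+ suc d * + suc e) ∎)
    where
    open ≡-Reasoning
    r = p ℚ.* q
    l1 : ∀ a b c d e → a * (b * c) * (d * e) ≡ (a * (d * e)) * b * c
    l1 = solve-∀
    l2 : ∀ a b c d e → (a * b * c) * d * e ≡ (a * d) * (b * e) * c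
    l2 = solve-∀
    l3 : ∀ a b c d e → (a * c) * (b * d) * e ≡ a * b * e * (c * d)
    l3 = solve-∀

  isRatio-+ : ∀ p q x y A B .{{_ : NonZero A}} .{{_ : NonZero B}} →
              IsRatio p x A → IsRatio q y B → IsRatio (p ℚ.+ q) (x * + B + y * + A) (A ℕ.* B)
  isRatio-+ p@(mkℚ n d _) q@(mkℚ m e _) x y A B p≐ q≐ = ℤ.*-cancelʳ-≡ _ _ (+ suc d * + suc e) (begin
    ↥ r * + (A ℕ.* B) * (+ suc d * + suc e)      ≡⟨ cong (λ z → ↥ r * z * (+ suc d * + suc e)) (ℤ.pos-* A B) ⟩
    ↥ r * (+ A * + B) * (+ suc d * + suc e)      ≡⟨ l1 (↥ r) (+ A) (+ B) (+ suc d) (+ suc e) ⟩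
    (↥ r * + (suc d ℕ.* suc e)) * + A * + B      ≡⟨ cong (λ z → z * + A * + B) (isRatio-/ (n * + suc e + m * + suc d) (suc d ℕ.* suc e)) ⟩
    ((n * + suc e + m * + suc d) * ↧ r) * + A * + B
      ≡⟨ l2 n m (+ suc d) (+ suc e) (↧ r) (+ A) (+ B) ⟩
    ((n * + A) * + suc e * + B + (m * + B) * + suc d * + A) * ↧ r
      ≡⟨ cong₂ (λ u v → (u * + suc e * + B + v * + suc d * + A) * ↧ r) p≐ q≐ ⟩
    ((x * + suc d) * + suc e * + B + (y * + suc e) * + suc d * + A) * ↧ r
      ≡⟨ l3 x y (+ suc d) (+ suc e) (↧ r) (+ A) (+ B) ⟩
    (x * + B + y * + A) * ↧ r * (+ suc d * + suc e) ∎)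
    where
    open ≡-Reasoning
    r = p ℚ.+ q
    l1 : ∀ a b c d e → a * (b * c) * (d * e) ≡ (a * (d * e)) * b * c
    l1 = solve-∀
    l2 : ∀ n m d e r a b → ((n * e + m * d) * r) * a * b ≡ ((n * a) * e * b + (m * b) * d * a) * r
    l2 = solve-∀
    l3 : ∀ x y d e r a b → ((x * d) * e * b + (y * e) * d * a) * r ≡ (x * b + y * a) * r * (d * e)
    l3 = solve-∀

  isRatio-neg : ∀ p x A → IsRatio p x A → IsRatio (ℚ.- p) (- x) A
  isRatio-neg p x A p≐ = begin
    ↥ (ℚ.- p) * + A  ≡⟨ cong (_* + A) (ℚ.↥-neg p) ⟩
    - ↥ p * + A      ≡⟨ ℤ.neg-distribˡ-* (↥ p) (+ A) ⟨
    - (↥ p * + A)    ≡⟨ cong -_ p≐ ⟩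
    - (x * ↧ p)      ≡⟨ ℤ.neg-distribˡ-* x (↧ p) ⟩
    - x * ↧ p        ≡⟨ cong (- x *_) (ℚ.↧-neg p) ⟨
    - x * ↧ (ℚ.- p) ∎
    where open ≡-Reasoning

  isRatio-≤ : ∀ p q x y A B .{{_ : NonZero A}} .{{_ : NonZero B}} →
              IsRatio p x A → IsRatio q y B → p ℚ.≤ q ⇔ x * + B ≤ y * + A
  isRatio-≤ p@(mkℚ n d _) q@(mkℚ m e _) x y A@(suc a) B@(suc b) p≐ q≐ =
    mk⇔ (λ { (*≤* le) → cancel d (cancel e (subst₂ _≤_ lhs rhs (scale b (scale a le)))) })
        (λ le → *≤* (cancel a (cancel b (subst₂ _≤_ (sym lhs) (sym rhs) (scale e (scale d le))))))
    where
    scale : ∀ {u v} k → u ≤ v → u * + suc k ≤ v * + suc k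
    scale k = ℤ.*-monoʳ-≤-nonNeg (+ suc k)
    cancel : ∀ {u v} k → u * + suc k ≤ v * + suc k → u ≤ v
    cancel {u} {v} k = ℤ.*-cancelʳ-≤-pos u v (+ suc k)
    lhs : n * + suc e * + A * + B ≡ x * + B * + suc d * + suc e
    lhs = begin
      n * + suc e * + A * + B        ≡⟨ l (n) (+ suc e) (+ A) (+ B) ⟩
      (n * + A) * + suc e * + B      ≡⟨ cong (λ z → z * + suc e * + B) p≐ ⟩
      (x * + suc d) * + suc e * + B  ≡⟨ l2 x (+ suc d) (+ suc e) (+ B) ⟩
      x * + B * + suc d * + suc e ∎
      where
      open ≡-Reasoning
      l : ∀ a b c d → a * b * c * d ≡ (a * c) * b * d
      l = solve-∀
      l2 : ∀ a b c d → (a * b) * c * d ≡ a * d * b * c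
      l2 = solve-∀
    rhs : m * + suc d * + A * + B ≡ y * + A * + suc d * + suc e
    rhs = begin
      m * + suc d * + A * + B        ≡⟨ l m (+ suc d) (+ A) (+ B) ⟩
      (m * + B) * + suc d * + A      ≡⟨ cong (λ z → z * + suc d * + A) q≐ ⟩
      (y * + suc e) * + suc d * + A  ≡⟨ l2 y (+ suc e) (+ suc d) (+ A) ⟩
      y * + A * + suc d * + suc e ∎
      where
      open ≡-Reasoning
      l : ∀ a b c d → a * b * c * d ≡ (a * d) * b * c
      l = solve-∀
      l2 : ∀ a b c d → (a * b) * c * d ≡ a * d * c * b
      l2 = solve-∀

  floor-remainder : ∀ q → Σ ℕ λ r → r ℕ.< ↧ₙ q × ↥ q ≡ + r + floor q * ↧ q
  floor-remainder (mkℚ n d _) = n ℤ.% + suc d , ℤ.n%d<d n (+ suc d) , ℤ.a≡a%n+[a/n]*n n (+ suc d)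

  ceiling-bounds : ∀ p x A .{{_ : NonZero A}} → IsRatio p x A → ceiling p * + A - + A < x × x ≤ ceiling p * + A
  ceiling-bounds p@(mkℚ n d _) x A@(suc a) p≐ with floor-remainder (ℚ.- p)
  ... | r , r<D , -n≡r+fD = lower , upper
    where
    D = + suc d
    c = ceiling p
    -n≡r+fD′ : - n ≡ + r + floor (ℚ.- p) * D
    -n≡r+fD′ = trans (sym (ℚ.↥-neg p)) (trans -n≡r+fD (cong (λ z → + r + floor (ℚ.- p) * z) (ℚ.↧-neg p)))
    n≡cD-r : n ≡ c * D - + r
    n≡cD-r = begin
      n                              ≡⟨ ℤ.neg-involutive n ⟨
      - (- n)                        ≡⟨ cong -_ -n≡r+fD′ ⟩
      - (+ r + floor (ℚ.- p) * D)    ≡⟨ l (+ r) (floor (ℚ.- p)) D ⟩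
      c * D - + r ∎
      where
      open ≡-Reasoning
      l : ∀ r f D → - (r + f * D) ≡ - f * D - r
      l = solve-∀
    xD≡nA : x * D ≡ n * + A
    xD≡nA = sym p≐
    upper : x ≤ c * + A
    upper = ℤ.*-cancelʳ-≤-pos x (c * + A) D (≤-of-≡+ (r ℕ.* A) (begin
      c * + A * D                       ≡⟨ l c (+ A) D (+ r) ⟩
      (c * D - + r) * + A + + r * + A   ≡⟨ cong₂ (λ u v → u * + A + v) (sym n≡cD-r) (sym (ℤ.pos-* r A)) ⟩
      n * + A + + (r ℕ.* A)             ≡⟨ cong (_+ + (r ℕ.* A)) (sym xD≡nA) ⟩
      x * D + + (r ℕ.* A) ∎))
      where
      open ≡-Reasoning
      l : ∀ c A D r → c * A * D ≡ (c * D - r) * A + r * A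
      l = solve-∀
    k = d ℕ.∸ r
    D≡r+1+k : + suc d ≡ + r + + suc k
    D≡r+1+k = trans (cong (λ t → + suc t) (sym (ℕ.m+[n∸m]≡n (ℕ.≤-pred (subst (r ℕ.<_) (ℤ.+-injective (ℚ.↧-neg p)) r<D)))))
                    (trans (cong +_ (sym (ℕ.+-suc r k))) (ℤ.pos-+ r (suc k)))
    lower : c * + A - + A < x
    lower = ℤ.*-cancelʳ-<-nonNeg D (<-of-≡+suc (a ℕ.+ k ℕ.* A) (begin
      x * D                                                ≡⟨ xD≡nA ⟩
      n * + A                                              ≡⟨ cong (_* + A) n≡cD-r ⟩
      (c * D - + r) * + A                                  ≡⟨ cong (λ z → (c * z - + r) * + A) D≡r+1+k ⟩
      (c * (+ r + + suc k) - + r) * + A                    ≡⟨ l c (+ r) (+ suc k) (+ A) ⟩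
      (c * + A - + A) * (+ r + + suc k) + + suc k * + A    ≡⟨ cong₂ (λ u v → (c * + A - + A) * u + v) (sym D≡r+1+k) (sym (ℤ.pos-* (suc k) A)) ⟩
      (c * + A - + A) * D + + (suc k ℕ.* A) ∎))
      where
      open ≡-Reasoning
      l : ∀ c r s A → (c * (r + s) - r) * A ≡ (c * A - A) * (r + s) + s * A
      l = solve-∀

  ceiling-unique : ∀ p x A c .{{_ : NonZero A}} → IsRatio p x A → c * + A - + A < x → x ≤ c * + A → ceiling p ≡ c
  ceiling-unique p x A@(suc _) c p≐ lower upper with ceiling-bounds p x A p≐
  ... | lower′ , upper′ = ℤ.≤-antisym (≤-of-bracket lower′ upper) (≤-of-bracket lower upper′)
    where
    ≤-of-bracket : ∀ {c₀ c₁} → c₀ * + A - + A < x → x ≤ c₁ * + A → c₀ ≤ c₁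
    ≤-of-bracket {c₀} {c₁} lo hi =
      subst (_≤ c₁) (l₂ c₀)
        (ℤ.i<j⇒suc[i]≤j (ℤ.*-cancelʳ-<-nonNeg {c₀ - + 1} (+ A) (subst (_< c₁ * + A) (l₁ c₀ (+ A)) (ℤ.<-≤-trans lo hi))))
      where
      l₁ : ∀ c A → c * A - A ≡ (c - + 1) * A
      l₁ = solve-∀
      l₂ : ∀ c → + 1 + (c - + 1) ≡ c
      l₂ = solve-∀


module Carries where

  open import Data.Nat using (ℕ; suc; NonZero; _+_; _*_; _<_; _≤_; _<?_)
  import Data.Nat.Properties as ℕ
  open import Data.Nat.DivMod using (_%_; [m+kn]%n≡m%n; m<n⇒m%n≡m)
  open import Data.Nat.Tactic.RingSolver using (solve)
  open import Data.List using ([]; _∷_)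
  open import Data.Product using (_×_; _,_)
  open import Data.Sum using (_⊎_; inj₁; inj₂)
  open import Relation.Nullary using (yes; no)
  open import Relation.Binary.PropositionalEquality
    using (_≡_; refl; sym; trans; cong; subst)

  -- ⌈z₁/A₁ − z₀/A₀⌉ for residues z₀ < A₀, z₁ < A₁ (ceiling-carry)
  carry : ℕ → ℕ → ℕ → ℕ → ℕ
  carry A₀ A₁ z₀ z₁ with z₀ * A₁ <? z₁ * A₀
  ... | yes _ = 1
  ... | no  _ = 0

  carry-cases : ∀ A₀ A₁ z₀ z₁ → (z₀ * A₁ < z₁ * A₀ × carry A₀ A₁ z₀ z₁ ≡ 1)
                              ⊎ (z₁ * A₀ ≤ z₀ * A₁ × carry A₀ A₁ z₀ z₁ ≡ 0)
  carry-cases A₀ A₁ z₀ z₁ with z₀ * A₁ <? z₁ * A₀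
  ... | yes lt = inj₁ (lt , refl)
  ... | no  ≮  = inj₂ (ℕ.≮⇒≥ ≮ , refl)

  divMod-unique : ∀ A t z t′ z′ .{{_ : NonZero A}} → z < A → z′ < A → A * t + z ≡ A * t′ + z′ → z ≡ z′ × t ≡ t′
  divMod-unique A t z t′ z′ z<A z′<A eq =
    z≡z′ , ℕ.*-cancelˡ-≡ t t′ A (ℕ.+-cancelʳ-≡ z (A * t) (A * t′) (trans eq (cong (A * t′ +_) (sym z≡z′))))
    where
    mod-A : ∀ t z → z < A → (A * t + z) % A ≡ z
    mod-A t z z<A = trans (cong (_% A) (trans (ℕ.+-comm (A * t) z) (cong (z +_) (ℕ.*-comm A t))))
                          (trans ([m+kn]%n≡m%n z t A) (m<n⇒m%n≡m z<A))
    z≡z′ : z ≡ z′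
    z≡z′ = trans (sym (mod-A t z z<A)) (trans (cong (_% A) eq) (mod-A t′ z′ z′<A))

  carry-bound⇒ratio-≤ : ∀ A₀ A₁ z₀ z₁ t₁ w → z₁ < A₁ →
    (A₁ * t₁ + z₁) * A₀ ≤ (A₀ * (t₁ + carry A₀ A₁ z₀ z₁ + w) + z₀) * A₁
  carry-bound⇒ratio-≤ A₀ A₁ z₀ z₁ t₁ w z₁<A₁ with carry-cases A₀ A₁ z₀ z₁
  ... | inj₁ (_ , c≡1) rewrite c≡1 = begin
    (A₁ * t₁ + z₁) * A₀                             ≡⟨ solve (A₀ ∷ A₁ ∷ t₁ ∷ z₁ ∷ []) ⟩
    A₁ * t₁ * A₀ + z₁ * A₀                          ≤⟨ ℕ.+-monoʳ-≤ (A₁ * t₁ * A₀) (ℕ.*-monoˡ-≤ A₀ (ℕ.<⇒≤ z₁<A₁)) ⟩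
    A₁ * t₁ * A₀ + A₁ * A₀                          ≤⟨ ℕ.m≤m+n _ _ ⟩
    A₁ * t₁ * A₀ + A₁ * A₀ + (A₀ * w * A₁ + z₀ * A₁) ≡⟨ solve (A₀ ∷ A₁ ∷ t₁ ∷ w ∷ z₀ ∷ []) ⟩
    (A₀ * (t₁ + 1 + w) + z₀) * A₁ ∎
    where open ℕ.≤-Reasoning
  ... | inj₂ (z₁A₀≤z₀A₁ , c≡0) rewrite c≡0 = begin
    (A₁ * t₁ + z₁) * A₀                  ≡⟨ solve (A₀ ∷ A₁ ∷ t₁ ∷ z₁ ∷ []) ⟩
    A₁ * t₁ * A₀ + z₁ * A₀               ≤⟨ ℕ.+-monoʳ-≤ (A₁ * t₁ * A₀) z₁A₀≤z₀A₁ ⟩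
    A₁ * t₁ * A₀ + z₀ * A₁               ≤⟨ ℕ.m≤m+n _ _ ⟩
    A₁ * t₁ * A₀ + z₀ * A₁ + A₀ * w * A₁ ≡⟨ solve (A₀ ∷ A₁ ∷ t₁ ∷ w ∷ z₀ ∷ []) ⟩
    (A₀ * (t₁ + 0 + w) + z₀) * A₁ ∎
    where open ℕ.≤-Reasoning

  ratio-≤⇒carry-bound : ∀ A₀ A₁ z₀ z₁ t₁ t₀ .{{_ : NonZero A₁}} → z₀ < A₀ →
    (A₁ * t₁ + z₁) * A₀ ≤ (A₀ * t₀ + z₀) * A₁ → t₁ + carry A₀ A₁ z₀ z₁ ≤ t₀
  ratio-≤⇒carry-bound A₀ A₁ z₀ z₁ t₁ t₀ z₀<A₀ ratio-≤ with carry-cases A₀ A₁ z₀ z₁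
  ... | inj₁ (z₀A₁<z₁A₀ , c≡1) rewrite c≡1 =
    ℕ.≮⇒≥ λ t₀<t₁+1 → ℕ.<⇒≱ (ratio-> (ℕ.≤-pred (subst (t₀ <_) (ℕ.+-comm t₁ 1) t₀<t₁+1))) ratio-≤
    where
    ratio-> : t₀ ≤ t₁ → (A₀ * t₀ + z₀) * A₁ < (A₁ * t₁ + z₁) * A₀
    ratio-> t₀≤t₁ = begin-strict
      (A₀ * t₀ + z₀) * A₁       ≡⟨ solve (A₀ ∷ A₁ ∷ t₀ ∷ z₀ ∷ []) ⟩
      A₀ * A₁ * t₀ + z₀ * A₁    ≤⟨ ℕ.+-monoˡ-≤ (z₀ * A₁) (ℕ.*-monoʳ-≤ (A₀ * A₁) t₀≤t₁) ⟩
      A₀ * A₁ * t₁ + z₀ * A₁    <⟨ ℕ.+-monoʳ-< (A₀ * A₁ * t₁) z₀A₁<z₁A₀ ⟩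
      A₀ * A₁ * t₁ + z₁ * A₀    ≡⟨ solve (A₀ ∷ A₁ ∷ t₁ ∷ z₁ ∷ []) ⟩
      (A₁ * t₁ + z₁) * A₀ ∎
      where open ℕ.≤-Reasoning
  ... | inj₂ (_ , c≡0) rewrite c≡0 =
    ℕ.≮⇒≥ λ t₀<t₁+0 → ℕ.<⇒≱ (ratio-> (subst (t₀ <_) (ℕ.+-identityʳ t₁) t₀<t₁+0)) ratio-≤
    where
    ratio-> : t₀ < t₁ → (A₀ * t₀ + z₀) * A₁ < (A₁ * t₁ + z₁) * A₀
    ratio-> t₀<t₁ = begin-strict
      (A₀ * t₀ + z₀) * A₁       ≡⟨ solve (A₀ ∷ A₁ ∷ t₀ ∷ z₀ ∷ []) ⟩
      A₀ * A₁ * t₀ + z₀ * A₁    <⟨ ℕ.+-monoʳ-< (A₀ * A₁ * t₀) (ℕ.*-monoˡ-< A₁ z₀<A₀) ⟩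
      A₀ * A₁ * t₀ + A₀ * A₁    ≡⟨ solve (A₀ ∷ A₁ ∷ t₀ ∷ []) ⟩
      A₀ * A₁ * suc t₀          ≤⟨ ℕ.*-monoʳ-≤ (A₀ * A₁) t₀<t₁ ⟩
      A₀ * A₁ * t₁              ≤⟨ ℕ.m≤m+n _ _ ⟩
      A₀ * A₁ * t₁ + z₁ * A₀    ≡⟨ solve (A₀ ∷ A₁ ∷ t₁ ∷ z₁ ∷ []) ⟩
      (A₁ * t₁ + z₁) * A₀ ∎
      where open ℕ.≤-Reasoning


module CeilingSteps where

  open Ratios
  open Carries using (carry; carry-cases)
  open import Data.Nat as ℕ using (ℕ; zero; suc; NonZero; z≤n)
  import Data.Nat.Properties as ℕ
  open import Data.Integer as ℤ using (ℤ; +_; _+_; _-_; _*_; -_; _≤_; _<_; +≤+; +<+)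
  import Data.Integer.Properties as ℤ
  open import Data.Integer.Tactic.RingSolver using (solve-∀)
  open import Data.Rational as ℚ using (ℚ; ceiling)
  open import Data.Product using (_×_; _,_; proj₁; proj₂)
  open import Data.Sum using (inj₁; inj₂)
  open import Relation.Binary.PropositionalEquality
    using (_≡_; sym; trans; cong; cong₂; subst; subst₂)

  frac : ℤ → (A : ℕ) → NonZero A → ℚ
  frac x A nz = (x ℚ./ A) {{nz}}

  ceiling-carry : ∀ A₀ A₁ z₀ z₁ (nz₀ : NonZero A₀) (nz₁ : NonZero A₁) → z₀ ℕ.< A₀ → z₁ ℕ.< A₁ →
                  ceiling (frac (+ z₁) A₁ nz₁ ℚ.- frac (+ z₀) A₀ nz₀) ≡ + carry A₀ A₁ z₀ z₁
  ceiling-carry A₀ A₁ z₀ z₁ nz₀ nz₁ z₀<A₀ z₁<A₁ =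
    ceiling-unique (frac (+ z₁) A₁ nz₁ ℚ.- frac (+ z₀) A₀ nz₀) (+ u - + v) N (+ carry A₀ A₁ z₀ z₁)
      ratio (proj₁ bounds) (proj₂ bounds)
    where
    instance
      _ = nz₀
      _ = nz₁
      _ = ℕ.m*n≢0 A₁ A₀
    u = z₁ ℕ.* A₀
    v = z₀ ℕ.* A₁
    N = A₁ ℕ.* A₀
    ratio : IsRatio (frac (+ z₁) A₁ nz₁ ℚ.- frac (+ z₀) A₀ nz₀) (+ u - + v) N
    ratio = subst (λ x → IsRatio (frac (+ z₁) A₁ nz₁ ℚ.- frac (+ z₀) A₀ nz₀) x N)
              (trans (l (+ z₁) (+ A₀) (+ z₀) (+ A₁)) (cong₂ _-_ (sym (ℤ.pos-* z₁ A₀)) (sym (ℤ.pos-* z₀ A₁))))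
              (isRatio-+ (frac (+ z₁) A₁ nz₁) (ℚ.- frac (+ z₀) A₀ nz₀) (+ z₁) (- + z₀) A₁ A₀
                 (isRatio-/ (+ z₁) A₁) (isRatio-neg (frac (+ z₀) A₀ nz₀) (+ z₀) A₀ (isRatio-/ (+ z₀) A₀)))
      where
      l : ∀ a b c d → a * b + - c * d ≡ a * b - c * d
      l = solve-∀
    u≤N : u ℕ.≤ N
    u≤N = ℕ.*-monoˡ-≤ A₀ (ℕ.<⇒≤ z₁<A₁)
    v<N : v ℕ.< N
    v<N = subst (v ℕ.<_) (ℕ.*-comm A₀ A₁) (ℕ.*-monoˡ-< A₁ z₀<A₀)
    -N<u-v : - + N < + u - + v
    -N<u-v = ℤ.<-≤-trans (ℤ.neg-mono-< (+<+ v<N)) (subst (_≤ + u - + v) (ℤ.+-identityˡ (- + v)) (ℤ.+-monoˡ-≤ (- + v) (+≤+ z≤n)))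
    bounds : + carry A₀ A₁ z₀ z₁ * + N - + N < + u - + v × + u - + v ≤ + carry A₀ A₁ z₀ z₁ * + N
    bounds with carry-cases A₀ A₁ z₀ z₁
    ... | inj₁ (v<u , c≡1) rewrite c≡1 =
      subst (_< + u - + v) (sym (1*N-N≡0 (+ N))) (subst (_< + u - + v) (ℤ.+-inverseʳ (+ v)) (ℤ.+-monoˡ-< (- + v) (+<+ v<u))) ,
      subst (+ u - + v ≤_) (sym (ℤ.*-identityˡ (+ N))) (ℤ.≤-trans (ℤ.i-j≤i (+ u) (+ v)) (+≤+ u≤N))
      where
      1*N-N≡0 : ∀ N → + 1 * N - N ≡ + 0
      1*N-N≡0 = solve-∀
    ... | inj₂ (u≤v , c≡0) rewrite c≡0 =
      subst (_< + u - + v) (sym (0*N-N≡-N (+ N))) -N<u-v ,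
      subst (+ u - + v ≤_) (sym (ℤ.*-zeroˡ (+ N))) (ℤ.i≤j⇒i-j≤0 (+≤+ u≤v))
      where
      0*N-N≡-N : ∀ N → + 0 * N - N ≡ - N
      0*N-N≡-N = solve-∀

  ceiling-zero : ∀ A (nz : NonZero A) → ceiling (frac (+ 0) A nz) ≡ + 0
  ceiling-zero A@(suc _) nz = ceiling-unique (frac (+ 0) A nz) (+ 0) A (+ 0) (isRatio-/ (+ 0) A) ℤ.-<+ (+≤+ z≤n)

  ceiling-shift : ∀ α A₀ t₀ z₀ (nz₀ : NonZero A₀) →
    ceiling (frac (+ α) A₀ nz₀ ℚ.* (+ (A₀ ℕ.* t₀ ℕ.+ z₀) ℚ./ 1)) ≡ + α * + t₀ + ceiling (frac (+ (α ℕ.* z₀)) A₀ nz₀)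
  ceiling-shift α A₀ t₀ z₀ nz₀ = ceiling-unique (frac (+ α) A₀ nz₀ ℚ.* (λ₀ ℚ./ 1)) (+ α * λ₀) A₀ c ratio lower upper
    where
    instance _ = nz₀
    λ₀ = + (A₀ ℕ.* t₀ ℕ.+ z₀)
    ratio : IsRatio (frac (+ α) A₀ nz₀ ℚ.* (λ₀ ℚ./ 1)) (+ α * λ₀) A₀
    ratio = subst (IsRatio (frac (+ α) A₀ nz₀ ℚ.* (λ₀ ℚ./ 1)) (+ α * λ₀)) (ℕ.*-identityʳ A₀)
                  (isRatio-* (frac (+ α) A₀ nz₀) (λ₀ ℚ./ 1) (+ α) λ₀ A₀ 1 (isRatio-/ (+ α) A₀) (isRatio-/ λ₀ 1))
    c₀ = ceiling (frac (+ (α ℕ.* z₀)) A₀ nz₀)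
    c₀-bounds = ceiling-bounds (frac (+ (α ℕ.* z₀)) A₀ nz₀) (+ (α ℕ.* z₀)) A₀ (isRatio-/ (+ (α ℕ.* z₀)) A₀)
    c = + α * + t₀ + c₀
    αλ₀≡ : + α * λ₀ ≡ + α * + t₀ * + A₀ + + (α ℕ.* z₀)
    αλ₀≡ = trans (cong (+ α *_) (trans (ℤ.pos-+ (A₀ ℕ.* t₀) z₀) (cong (_+ + z₀) (ℤ.pos-* A₀ t₀))))
                 (trans (l (+ α) (+ A₀) (+ t₀) (+ z₀)) (cong (λ x → + α * + t₀ * + A₀ + x) (sym (ℤ.pos-* α z₀))))
      where
      l : ∀ a A t z → a * (A * t + z) ≡ a * t * A + a * z
      l = solve-∀
    cA≡ : ∀ u → c * u ≡ + α * + t₀ * u + c₀ * u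
    cA≡ u = ℤ.*-distribʳ-+ u (+ α * + t₀) c₀
    lower : c * + A₀ - + A₀ < + α * λ₀
    lower = subst₂ _<_ (trans (sym (ℤ.+-assoc (+ α * + t₀ * + A₀) (c₀ * + A₀) (- + A₀))) (cong (_- + A₀) (sym (cA≡ (+ A₀)))))
                       (sym αλ₀≡) (ℤ.+-monoʳ-< (+ α * + t₀ * + A₀) (proj₁ c₀-bounds))
    upper : + α * λ₀ ≤ c * + A₀
    upper = subst₂ _≤_ (sym αλ₀≡) (sym (cA≡ (+ A₀))) (ℤ.+-monoʳ-≤ (+ α * + t₀ * + A₀) (proj₂ c₀-bounds))


module Chains where

  open Boxes using (Box)
  open Ratios
  open Carries
  open CeilingSteps using (frac)
  open import Data.Nat as ℕ using (ℕ; zero; suc; NonZero; z≤n)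
  import Data.Nat.Properties as ℕ
  open import Data.Nat.DivMod using (_%_; _/_; m%n<n; m≡m%n+[m/n]*n)
  open import Data.Integer as ℤ using (ℤ; +_; -[1+_]; +≤+)
  import Data.Integer.Properties as ℤ
  open import Data.Rational as ℚ using (ℚ)
  open import Data.Fin using (Fin; zero; suc; inject₁; fromℕ)
  open import Data.Vec using (Vec; []; _∷_; lookup; replicate)
  open import Data.Product using (∃; _×_; _,_)
  open import Function using (_∘_)
  open import Function.Bundles using (_⇔_; mk⇔; Equivalence)
  open import Relation.Nullary using (contradiction)
  open import Relation.Binary.PropositionalEquality
    using (_≡_; refl; sym; trans; cong; subst; subst₂)
  open Equivalence

  -- Entry i is A_i t_i + z_i, where t_i = t_{i+1} + carry_i + w_i and t_last = w_last.
  firstQuotient : ∀ q → (Fin (suc q) → ℕ) → Vec ℕ (suc q) → Vec ℕ (suc q) → ℕ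
  firstQuotient zero    A (z₀ ∷ [])      (w₀ ∷ [])  = w₀
  firstQuotient (suc q) A (z₀ ∷ z₁ ∷ zs) (w₀ ∷ ws) =
    firstQuotient q (A ∘ suc) (z₁ ∷ zs) ws ℕ.+ carry (A zero) (A (suc zero)) z₀ z₁ ℕ.+ w₀

  assemble : ∀ q → (Fin (suc q) → ℕ) → Vec ℕ (suc q) → Vec ℕ (suc q) → Vec ℤ (suc q)
  assemble zero    A (z₀ ∷ [])      (w₀ ∷ [])  = + (A zero ℕ.* w₀ ℕ.+ z₀) ∷ []
  assemble (suc q) A (z₀ ∷ z₁ ∷ zs) (w₀ ∷ ws) =
    + (A zero ℕ.* firstQuotient (suc q) A (z₀ ∷ z₁ ∷ zs) (w₀ ∷ ws) ℕ.+ z₀) ∷ assemble q (A ∘ suc) (z₁ ∷ zs) ws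

  lookup-assemble-zero : ∀ q A z₀ zs w →
    lookup (assemble q A (z₀ ∷ zs) w) zero ≡ + (A zero ℕ.* firstQuotient q A (z₀ ∷ zs) w ℕ.+ z₀)
  lookup-assemble-zero zero    A z₀ []        (w₀ ∷ [])  = refl
  lookup-assemble-zero (suc q) A z₀ (z₁ ∷ zs) (w₀ ∷ ws) = refl

  Descending : ∀ q → (Fin (suc q) → ℕ) → Vec ℤ (suc q) → Set
  Descending zero    A (x ∷ [])  = + 0 ℤ.≤ x
  Descending (suc q) A (x ∷ ys) = lookup ys zero ℤ.* + A zero ℤ.≤ x ℤ.* + A (suc zero) × Descending q (A ∘ suc) ys

  assemble-descending : ∀ q A z w → Box (suc q) A z → Descending q A (assemble q A z w)
  assemble-descending zero    A (z₀ ∷ [])      (w₀ ∷ [])  _ = +≤+ z≤n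
  assemble-descending (suc q) A (z₀ ∷ z₁ ∷ zs) (w₀ ∷ ws) (_ , inBox@(z₁<A₁ , _)) =
    subst₂ ℤ._≤_ (trans (ℤ.pos-* λ₁ (A zero)) (cong (ℤ._* + A zero) (sym (lookup-assemble-zero q (A ∘ suc) z₁ zs ws))))
                 (ℤ.pos-* λ₀ (A (suc zero)))
      (+≤+ (carry-bound⇒ratio-≤ (A zero) (A (suc zero)) z₀ z₁ t₁ w₀ z₁<A₁)) ,
    assemble-descending q (A ∘ suc) (z₁ ∷ zs) ws inBox
    where
    t₁ = firstQuotient q (A ∘ suc) (z₁ ∷ zs) ws
    λ₁ = A (suc zero) ℕ.* t₁ ℕ.+ z₁
    λ₀ = A zero ℕ.* firstQuotient (suc q) A (z₀ ∷ z₁ ∷ zs) (w₀ ∷ ws) ℕ.+ z₀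

  private
    divMod-eq : ∀ n A .{{_ : NonZero A}} → A ℕ.* (n / A) ℕ.+ n % A ≡ n
    divMod-eq n A = trans (ℕ.+-comm (A ℕ.* (n / A)) (n % A))
                          (trans (cong (n % A ℕ.+_) (ℕ.*-comm A (n / A))) (sym (m≡m%n+[m/n]*n n A)))

  Assembled : ∀ q → (Fin (suc q) → ℕ) → Vec ℤ (suc q) → Set
  Assembled q A V = ∃ λ ((z , w) : Vec ℕ (suc q) × Vec ℕ (suc q)) → Box (suc q) A z × assemble q A z w ≡ V

  descending-assembled : ∀ q A (Apos : ∀ i → NonZero (A i)) V → Descending q A V → Assembled q A V
  descending-assembled zero A Apos (+ n ∷ []) _ =
    (n % A zero ∷ [] , n / A zero ∷ []) , (m%n<n n (A zero) , _) , cong (λ k → + k ∷ []) (divMod-eq n (A zero))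
    where instance _ = Apos zero
  descending-assembled (suc q) A Apos (x ∷ ys) (λ₁A₀≤xA₁ , descending)
    with descending-assembled q (A ∘ suc) (Apos ∘ suc) ys descending
  ... | (z₁ ∷ zs , ws) , inBox , refl = headOf x λ₁A₀≤xA₁
    where
    instance
      _ = Apos zero
      _ = Apos (suc zero)
    A₀ = A zero
    A₁ = A (suc zero)
    t₁ = firstQuotient q (A ∘ suc) (z₁ ∷ zs) ws
    λ₁≡ : lookup (assemble q (A ∘ suc) (z₁ ∷ zs) ws) zero ≡ + (A₁ ℕ.* t₁ ℕ.+ z₁)
    λ₁≡ = lookup-assemble-zero q (A ∘ suc) z₁ zs ws
    headOf : ∀ x → lookup (assemble q (A ∘ suc) (z₁ ∷ zs) ws) zero ℤ.* + A₀ ℤ.≤ x ℤ.* + A₁ →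
             Assembled (suc q) A (x ∷ assemble q (A ∘ suc) (z₁ ∷ zs) ws)
    headOf -[1+ k ] λ₁A₀≤xA₁ = contradiction (ℤ.≤-trans 0≤λ₁A₀ λ₁A₀≤xA₁) (ℤ.<⇒≱ (neg*pos k))
      where
      0≤λ₁A₀ : + 0 ℤ.≤ lookup (assemble q (A ∘ suc) (z₁ ∷ zs) ws) zero ℤ.* + A₀
      0≤λ₁A₀ = subst (λ λ₁ → + 0 ℤ.≤ λ₁ ℤ.* + A₀) (sym λ₁≡) (subst (+ 0 ℤ.≤_) (ℤ.pos-* (A₁ ℕ.* t₁ ℕ.+ z₁) A₀) (+≤+ z≤n))
      neg*pos : ∀ k → -[1+ k ] ℤ.* + A₁ ℤ.< + 0
      neg*pos k with A₁ | Apos (suc zero)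
      ... | suc _ | _ = ℤ.-<+
    headOf (+ n) λ₁A₀≤nA₁ =
      (n % A₀ ∷ z₁ ∷ zs , w₀ ∷ ws) , (m%n<n n A₀ , inBox) , cong (λ k → + k ∷ assemble q (A ∘ suc) (z₁ ∷ zs) ws) λ₀≡n
      where
      c = carry A₀ A₁ (n % A₀) z₁
      ratio-≤ : (A₁ ℕ.* t₁ ℕ.+ z₁) ℕ.* A₀ ℕ.≤ (A₀ ℕ.* (n / A₀) ℕ.+ n % A₀) ℕ.* A₁
      ratio-≤ = ℤ.drop‿+≤+ (subst₂ ℤ._≤_
        (trans (cong (ℤ._* + A₀) λ₁≡) (sym (ℤ.pos-* (A₁ ℕ.* t₁ ℕ.+ z₁) A₀)))
        (trans (cong (λ m → + m ℤ.* + A₁) (sym (divMod-eq n A₀))) (sym (ℤ.pos-* (A₀ ℕ.* (n / A₀) ℕ.+ n % A₀) A₁)))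
        λ₁A₀≤nA₁)
      t₁+c≤n/A₀ : t₁ ℕ.+ c ℕ.≤ n / A₀
      t₁+c≤n/A₀ = ratio-≤⇒carry-bound A₀ A₁ (n % A₀) z₁ t₁ (n / A₀) (m%n<n n A₀) ratio-≤
      w₀ = n / A₀ ℕ.∸ (t₁ ℕ.+ c)
      λ₀≡n : A₀ ℕ.* (t₁ ℕ.+ c ℕ.+ w₀) ℕ.+ n % A₀ ≡ n
      λ₀≡n = trans (cong (λ t → A₀ ℕ.* t ℕ.+ n % A₀) (ℕ.m+[n∸m]≡n t₁+c≤n/A₀)) (divMod-eq n A₀)

  assemble-injective : ∀ q A (Apos : ∀ i → NonZero (A i)) z w z′ w′ → Box (suc q) A z → Box (suc q) A z′ →
                       assemble q A z w ≡ assemble q A z′ w′ → z ≡ z′ × w ≡ w′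
  assemble-injective zero A Apos (z₀ ∷ []) (w₀ ∷ []) (z₀′ ∷ []) (w₀′ ∷ []) (z₀< , _) (z₀′< , _) eq
    with divMod-unique (A zero) w₀ z₀ w₀′ z₀′ {{Apos zero}} z₀< z₀′< (ℤ.+-injective (cong (λ V → lookup V zero) eq))
  ... | refl , refl = refl , refl
  assemble-injective (suc q) A Apos (z₀ ∷ z₁ ∷ zs) (w₀ ∷ ws) (z₀′ ∷ z₁′ ∷ zs′) (w₀′ ∷ ws′) (z₀< , inBox) (z₀′< , inBox′) eq
    with assemble-injective q (A ∘ suc) (Apos ∘ suc) (z₁ ∷ zs) ws (z₁′ ∷ zs′) ws′ inBox inBox′ (cong Data.Vec.tail eq)
  ... | refl , refl with divMod-unique (A zero) _ z₀ _ z₀′ {{Apos zero}} z₀< z₀′< (ℤ.+-injective (cong (λ V → lookup V zero) eq))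
  ...   | refl , t₀≡t₀′ =
    refl , cong (_∷ ws) (ℕ.+-cancelˡ-≡ (firstQuotient q (A ∘ suc) (z₁ ∷ zs) ws ℕ.+ carry (A zero) (A (suc zero)) z₀ z₁) w₀ w₀′ t₀≡t₀′)

  TailCond : ∀ q (A : Fin (suc q) → ℕ) → (∀ i → NonZero (A i)) → Vec ℤ (suc q) → Set
  TailCond q A Apos V =
      (∀ (j : Fin q) → frac (lookup V (suc j)) (A (suc j)) (Apos (suc j))
                         ℚ.≤ frac (lookup V (inject₁ j)) (A (inject₁ j)) (Apos (inject₁ j)))
    × ℚ.0ℚ ℚ.≤ frac (lookup V (fromℕ q)) (A (fromℕ q)) (Apos (fromℕ q))

  frac-≤⇔ : ∀ x y A B (nzA : NonZero A) (nzB : NonZero B) → frac x A nzA ℚ.≤ frac y B nzB ⇔ x ℤ.* + B ℤ.≤ y ℤ.* + A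
  frac-≤⇔ x y A B nzA nzB = isRatio-≤ (frac x A nzA) (frac y B nzB) x y A B {{nzA}} {{nzB}} (isRatio-/ x A {{nzA}}) (isRatio-/ y B {{nzB}})

  TailCond⇔Descending : ∀ q A Apos V → TailCond q A Apos V ⇔ Descending q A V
  TailCond⇔Descending zero A Apos (x ∷ []) =
    mk⇔ (λ (_ , 0≤x/A) → subst (+ 0 ℤ.≤_) (ℤ.*-identityʳ x) (to 0≤⇔ 0≤x/A))
        (λ 0≤x → (λ ()) , from 0≤⇔ (subst (+ 0 ℤ.≤_) (sym (ℤ.*-identityʳ x)) 0≤x))
    where
    0≤⇔ = isRatio-≤ ℚ.0ℚ (frac x (A zero) (Apos zero)) (+ 0) x 1 (A zero) {{_}} {{Apos zero}} refl (isRatio-/ x (A zero) {{Apos zero}})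
  TailCond⇔Descending (suc q) A Apos (x ∷ y ∷ ys) =
    mk⇔ (λ (steps , last) → to step (steps zero) , to rest ((steps ∘ suc) , last))
        (λ (yA₀≤xA₁ , descending) → let (steps , last) = from rest descending in
          (λ { zero → from step yA₀≤xA₁ ; (suc j) → steps j }) , last)
    where
    rest = TailCond⇔Descending q (A ∘ suc) (Apos ∘ suc) (y ∷ ys)
    step = frac-≤⇔ y x (A (suc zero)) (A zero) (Apos (suc zero)) (Apos zero)

  ≤-firstQuotient : ∀ q A z w j → lookup w j ℕ.≤ firstQuotient q A z w
  ≤-firstQuotient zero    A (z₀ ∷ [])      (w₀ ∷ [])  zero    = ℕ.≤-refl
  ≤-firstQuotient (suc q) A (z₀ ∷ z₁ ∷ zs) (w₀ ∷ ws) zero    = ℕ.m≤n+m w₀ _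
  ≤-firstQuotient (suc q) A (z₀ ∷ z₁ ∷ zs) (w₀ ∷ ws) (suc j) =
    ℕ.≤-trans (≤-firstQuotient q (A ∘ suc) (z₁ ∷ zs) ws j) (ℕ.≤-trans (ℕ.m≤m+n _ _) (ℕ.m≤m+n _ w₀))

  vsum-assemble : ∀ q A z w → ∃ λ k → vsum (assemble q A z w) ≡ lookup (assemble q A z w) zero ℤ.+ + k
  vsum-assemble zero    A (z₀ ∷ [])      (w₀ ∷ [])  = 0 , refl
  vsum-assemble (suc q) A (z₀ ∷ z₁ ∷ zs) (w₀ ∷ ws) with vsum-assemble q (A ∘ suc) (z₁ ∷ zs) ws
  ... | k , vsum≡ = _ , cong (λ s → lookup (assemble (suc q) A (z₀ ∷ z₁ ∷ zs) (w₀ ∷ ws)) zero ℤ.+ s)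
                           (trans vsum≡ (trans (cong (ℤ._+ + k) (lookup-assemble-zero q (A ∘ suc) z₁ zs ws))
                                               (sym (ℤ.pos-+ _ k))))

  zeros-inBox : ∀ p B → (∀ i → NonZero (B i)) → Box p B (replicate p 0)
  zeros-inBox zero    B nz = _
  zeros-inBox (suc p) B nz = ℕ.>-nonZero⁻¹ (B zero) {{nz zero}} , zeros-inBox p (B ∘ suc) (nz ∘ suc)


module Sums where

  open Partitions using (weight)
  open import Data.Nat as ℕ using (ℕ; zero; suc)
  open import Data.Integer using (ℤ; +_; _+_; _*_)
  import Data.Integer.Properties as ℤ
  open import Data.Integer.Tactic.RingSolver using (solve-∀)
  open import Data.Fin using (Fin; zero; suc)
  open import Data.Vec using (Vec; []; _∷_; lookup; replicate)
  open import Data.Vec.Properties using (lookup-replicate)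
  open import Function using (_∘_)
  open import Relation.Binary.PropositionalEquality using (_≡_; refl; sym; trans; cong; cong₂)

  ∑-cong : ∀ n f g → (∀ i → f i ≡ g i) → ∑ n f ≡ ∑ n g
  ∑-cong zero    f g f≗g = refl
  ∑-cong (suc n) f g f≗g = cong₂ _+_ (f≗g zero) (∑-cong n (f ∘ suc) (g ∘ suc) (f≗g ∘ suc))

  ∑-zero : ∀ n f → (∀ i → f i ≡ + 0) → ∑ n f ≡ + 0
  ∑-zero zero    f f≗0 = refl
  ∑-zero (suc n) f f≗0 = cong₂ _+_ (f≗0 zero) (∑-zero n (f ∘ suc) (f≗0 ∘ suc))

  ∑-+ : ∀ n f g → ∑ n (λ i → f i + g i) ≡ ∑ n f + ∑ n g
  ∑-+ zero    f g = refl
  ∑-+ (suc n) f g =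
    trans (cong (λ s → f zero + g zero + s) (∑-+ n (f ∘ suc) (g ∘ suc))) (l (f zero) (g zero) (∑ n (f ∘ suc)) (∑ n (g ∘ suc)))
    where
    l : ∀ a b c d → a + b + (c + d) ≡ (a + c) + (b + d)
    l = solve-∀

  vsum≡∑ : ∀ n (V : Vec ℤ n) → vsum V ≡ ∑ n (lookup V)
  vsum≡∑ zero    []       = refl
  vsum≡∑ (suc n) (x ∷ V) = cong (λ s → x + s) (vsum≡∑ n V)

  unitVec : ∀ n → Fin n → Vec ℕ n
  unitVec (suc n) zero    = 1 ∷ replicate n 0
  unitVec (suc n) (suc j) = 0 ∷ unitVec n j

  lookup-unitVec : ∀ n j → lookup (unitVec n j) j ≡ 1
  lookup-unitVec (suc n) zero    = refl
  lookup-unitVec (suc n) (suc j) = lookup-unitVec n j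

  ∑-unitVec : ∀ n (g : Fin n → ℤ) j → ∑ n (λ i → g i * + lookup (unitVec n j) i) ≡ g j
  ∑-unitVec (suc n) g zero =
    trans (cong₂ _+_ (ℤ.*-identityʳ (g zero))
                     (∑-zero n _ (λ i → trans (cong (λ u → g (suc i) * + u) (lookup-replicate i 0)) (ℤ.*-zeroʳ (g (suc i))))))
          (ℤ.+-identityʳ (g zero))
  ∑-unitVec (suc n) g (suc j) =
    trans (cong₂ _+_ (ℤ.*-zeroʳ (g zero)) (∑-unitVec n (g ∘ suc) j)) (ℤ.+-identityˡ (g (suc j)))

  weight≡∑ : ∀ n d (B : Fin n → ℤ) → (∀ i → B i ≡ + suc (d i)) → ∀ u → + weight n d u ≡ ∑ n (λ i → B i * + lookup u i)
  weight≡∑ zero    d B B≡ []      = refl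
  weight≡∑ (suc n) d B B≡ (x ∷ u) =
    trans (ℤ.pos-+ (suc (d zero) ℕ.* x) _)
          (cong₂ _+_ (trans (ℤ.pos-* (suc (d zero)) x) (cong (_* + x) (sym (B≡ zero))))
                     (weight≡∑ n (d ∘ suc) (B ∘ suc) (B≡ ∘ suc) u))


module AssembledWeight where

  open Sums
  open Boxes using (Box)
  open Carries using (carry)
  open CeilingSteps using (frac; ceiling-carry)
  open Chains using (firstQuotient; assemble)
  open import Data.Nat as ℕ using (ℕ; zero; suc; NonZero)
  open import Data.Integer using (ℤ; +_; _+_; _*_)
  import Data.Integer.Properties as ℤ
  open import Data.Integer.Tactic.RingSolver using (solve-∀)
  open import Data.Rational as ℚ using (ceiling)
  open import Data.Fin using (Fin; zero; suc; inject₁; inject≤; toℕ)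
  open import Data.Fin.Properties using (toℕ<n)
  open import Data.Vec using (Vec; []; _∷_; lookup)
  open import Data.Product using (_,_)
  open import Function using (_∘_)
  open import Relation.Binary.PropositionalEquality
    using (_≡_; sym; trans; cong; cong₂; module ≡-Reasoning)

  partialSum : ∀ q → ℤ → (Fin (suc q) → ℤ) → Fin (suc q) → ℤ
  partialSum q G F j = G + ∑ (suc (toℕ j)) (λ t → F (inject≤ t (toℕ<n j)))

  partialSum-suc : ∀ q G F j → partialSum (suc q) G F (suc j) ≡ partialSum q (G + F zero) (F ∘ suc) j
  partialSum-suc q G F j = sym (ℤ.+-assoc G (F zero) _)

  increment : ∀ q → (Fin (suc q) → ℕ) → (Fin (suc q) → ℤ) → Fin (suc q) → ℤ
  increment q A P j = (P j + + 1) * + A j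

  ceilingStep : ∀ q (A : Fin (suc q) → ℕ) → (∀ i → NonZero (A i)) → Vec ℕ (suc q) → Fin q → ℤ
  ceilingStep q A Apos z j = ceiling (frac (+ lookup z (suc j)) (A (suc j)) (Apos (suc j))
                                 ℚ.- frac (+ lookup z (inject₁ j)) (A (inject₁ j)) (Apos (inject₁ j)))

  assemble-weight : ∀ q A (Apos : ∀ i → NonZero (A i)) P G z w → Box (suc q) A z →
    G * + firstQuotient q A z w + ∑ (suc q) (λ j → (P j + + 1) * lookup (assemble q A z w) j)
    ≡ ∑ (suc q) (λ j → (P j + + 1) * + lookup z j)
      + ∑ q (λ j → partialSum q G (increment q A P) (inject₁ j) * ceilingStep q A Apos z j)
      + ∑ (suc q) (λ j → partialSum q G (increment q A P) j * + lookup w j)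
  assemble-weight zero A Apos P G (z₀ ∷ []) (w₀ ∷ []) _ =
    trans (cong (λ u → G * + w₀ + ((P zero + + 1) * u + + 0))
                (trans (ℤ.pos-+ (A zero ℕ.* w₀) z₀) (cong (_+ + z₀) (ℤ.pos-* (A zero) w₀))))
          (l G (P zero) (+ A zero) (+ w₀) (+ z₀))
    where
    l : ∀ G p a w z → G * w + ((p + + 1) * (a * w + z) + + 0) ≡ ((p + + 1) * z + + 0) + + 0 + ((G + ((p + + 1) * a + + 0)) * w + + 0)
    l = solve-∀
  assemble-weight (suc q) A Apos P G (z₀ ∷ z₁ ∷ zs) (w₀ ∷ ws) (z₀<A₀ , inBox@(z₁<A₁ , _)) = begin
    G * + t₀ + ((p₀ + + 1) * + (A₀ ℕ.* t₀ ℕ.+ z₀) + S)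
      ≡⟨ cong₂ (λ u v → G * u + ((p₀ + + 1) * v + S)) t₀≡ λ₀≡ ⟩
    G * (+ t₁ + + e + + w₀) + ((p₀ + + 1) * (+ A₀ * (+ t₁ + + e + + w₀) + + z₀) + S)
      ≡⟨ l₁ G p₀ (+ A₀) (+ t₁) (+ e) (+ w₀) (+ z₀) S ⟩
    (G′ * + t₁ + S) + G′ * (+ e + + w₀) + (p₀ + + 1) * + z₀
      ≡⟨ cong (λ u → u + G′ * (+ e + + w₀) + (p₀ + + 1) * + z₀) IH ⟩
    (Zt + Et + Wt) + G′ * (+ e + + w₀) + (p₀ + + 1) * + z₀
      ≡⟨ l₂ Zt Et Wt G (p₀ + + 1) (+ A₀) (+ e) (+ w₀) (+ z₀) ⟩
    ((p₀ + + 1) * + z₀ + Zt) + (B₀ * + e + Et) + (B₀ * + w₀ + Wt)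
      ≡⟨ cong₂ (λ u v → ((p₀ + + 1) * + z₀ + Zt) + u + v)
           (cong₂ (λ u v → B₀ * u + v) (sym e≡ceiling)
                  (∑-cong q _ _ (λ j → cong (_* ceilingStep (suc q) A Apos (z₀ ∷ z₁ ∷ zs) (suc j))
                                            (sym (partialSum-suc q G F (inject₁ j))))))
           (cong (λ u → B₀ * + w₀ + u) (∑-cong (suc q) _ _ (λ j → cong (_* + lookup ws j) (sym (partialSum-suc q G F j))))) ⟩
    ((p₀ + + 1) * + z₀ + Zt)
      + ∑ (suc q) (λ j → partialSum (suc q) G F (inject₁ j) * ceilingStep (suc q) A Apos (z₀ ∷ z₁ ∷ zs) j)
      + ∑ (suc (suc q)) (λ j → partialSum (suc q) G F j * + lookup (w₀ ∷ ws) j) ∎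
    where
    open ≡-Reasoning
    A₀ = A zero
    p₀ = P zero
    F = increment (suc q) A P
    t₁ = firstQuotient q (A ∘ suc) (z₁ ∷ zs) ws
    e = carry A₀ (A (suc zero)) z₀ z₁
    t₀ = t₁ ℕ.+ e ℕ.+ w₀
    G′ = G + F zero
    B₀ = G + ((p₀ + + 1) * + A₀ + + 0)
    S = ∑ (suc q) (λ j → (P (suc j) + + 1) * lookup (assemble q (A ∘ suc) (z₁ ∷ zs) ws) j)
    Zt = ∑ (suc q) (λ j → (P (suc j) + + 1) * + lookup (z₁ ∷ zs) j)
    Et = ∑ q (λ j → partialSum q G′ (increment q (A ∘ suc) (P ∘ suc)) (inject₁ j) * ceilingStep q (A ∘ suc) (Apos ∘ suc) (z₁ ∷ zs) j)
    Wt = ∑ (suc q) (λ j → partialSum q G′ (increment q (A ∘ suc) (P ∘ suc)) j * + lookup ws j)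
    IH : G′ * + t₁ + S ≡ Zt + Et + Wt
    IH = assemble-weight q (A ∘ suc) (Apos ∘ suc) (P ∘ suc) G′ (z₁ ∷ zs) ws inBox
    t₀≡ : + t₀ ≡ + t₁ + + e + + w₀
    t₀≡ = trans (ℤ.pos-+ (t₁ ℕ.+ e) w₀) (cong (_+ + w₀) (ℤ.pos-+ t₁ e))
    λ₀≡ : + (A₀ ℕ.* t₀ ℕ.+ z₀) ≡ + A₀ * (+ t₁ + + e + + w₀) + + z₀
    λ₀≡ = trans (ℤ.pos-+ (A₀ ℕ.* t₀) z₀) (cong (_+ + z₀) (trans (ℤ.pos-* A₀ t₀) (cong (+ A₀ *_) t₀≡)))
    e≡ceiling : ceilingStep (suc q) A Apos (z₀ ∷ z₁ ∷ zs) zero ≡ + e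
    e≡ceiling = ceiling-carry A₀ (A (suc zero)) z₀ z₁ (Apos zero) (Apos (suc zero)) z₀<A₀ z₁<A₁
    l₁ : ∀ G p a t e w z S → G * (t + e + w) + ((p + + 1) * (a * (t + e + w) + z) + S)
                           ≡ ((G + (p + + 1) * a) * t + S) + (G + (p + + 1) * a) * (e + w) + (p + + 1) * z
    l₁ = solve-∀
    l₂ : ∀ Zt Et Wt G p a e w z → (Zt + Et + Wt) + (G + p * a) * (e + w) + p * z
                                ≡ (p * z + Zt) + ((G + (p * a + + 0)) * e + Et) + ((G + (p * a + + 0)) * w + Wt)
    l₂ = solve-∀


module Corollary5Proof
    (m : Data.Nat.ℕ) (a : Data.Fin.Fin (2 Data.Nat.+ m) → Data.Nat.ℕ)
    (apos : ∀ i → Data.Nat.NonZero (a i)) (c : Data.Fin.Fin (2 Data.Nat.+ m) → Data.Integer.ℤ) where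

  open Setup m a apos c
  open Counting
  open Partitions using (weight)
  open Series
  open Boxes
  open CeilingSteps
  open Chains
  open Sums
  open AssembledWeight
  open import Data.Nat as ℕ using (ℕ; zero; suc; NonZero)
  import Data.Nat.Properties as ℕ
  open import Data.Integer as ℤ using (ℤ; +_; _+_; _-_; _*_)
  import Data.Integer.Properties as ℤ
  open import Data.Integer.Tactic.RingSolver using (solve-∀)
  open import Data.Rational as ℚ using (ceiling)
  open import Data.Fin using (Fin; zero; suc; inject₁)
  open import Data.Vec using (Vec; _∷_; lookup; replicate)
  open import Data.Vec.Properties using (lookup-replicate)
  open import Data.Product using (∃; _×_; _,_; proj₁; proj₂)
  open import Function using (_∘_)
  open import Function.Bundles using (_⇔_; mk⇔; Equivalence)
  open import Relation.Binary.PropositionalEquality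
    using (_≡_; refl; sym; trans; cong; cong₂; subst; module ≡-Reasoning)
  open Equivalence

  A : Fin (suc m) → ℕ
  A = a ∘ suc

  Apos : ∀ j → NonZero (A j)
  Apos = apos ∘ suc

  P : Fin (suc m) → ℤ
  P = c ∘ suc

  G₀ : ℤ
  G₀ = c zero * + a zero

  lowerBound : Vec ℤ (suc m) → ℤ
  lowerBound V = c zero * ceiling (((+ a zero) /a suc zero) ℚ.* (lookup V zero ℚ./ 1)) + ∑ (suc m) (λ j → P j * lookup V j)

  -- residues z_2, …, z_k and slacks (λ₁ − lowerBound, w_2, …, w_k)
  Coords : Set
  Coords = Vec ℕ (suc m) × Vec ℕ (2 ℕ.+ m)

  toSolution : Coords → Vec ℤ (2 ℕ.+ m)
  toSolution (z , s ∷ w) = lowerBound (assemble m A z w) + + s ∷ assemble m A z w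

  ∑-coefficients : ∀ V → ∑ (suc m) (λ j → P j * lookup V j) + vsum V ≡ ∑ (suc m) (λ j → (P j + + 1) * lookup V j)
  ∑-coefficients V = begin
    ∑ (suc m) (λ j → P j * lookup V j) + vsum V                    ≡⟨ cong (λ s → ∑ (suc m) (λ j → P j * lookup V j) + s) (vsum≡∑ (suc m) V) ⟩
    ∑ (suc m) (λ j → P j * lookup V j) + ∑ (suc m) (lookup V)      ≡⟨ ∑-+ (suc m) (λ j → P j * lookup V j) (lookup V) ⟨
    ∑ (suc m) (λ j → P j * lookup V j + lookup V j)                ≡⟨ ∑-cong (suc m) _ _ (λ j → l (P j) (lookup V j)) ⟩
    ∑ (suc m) (λ j → (P j + + 1) * lookup V j) ∎
    where
    open ≡-Reasoning
    l : ∀ p x → p * x + x ≡ (p + + 1) * x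
    l = solve-∀

  vsum-toSolution : ∀ z s w → Box (suc m) A z →
                    vsum (toSolution (z , s ∷ w)) ≡ expo z + ∑ (2 ℕ.+ m) (λ i → b i * + lookup (s ∷ w) i)
  vsum-toSolution (z₀ ∷ zs) s w inBox = begin
    (lowerBound V + + s) + vsum V                            ≡⟨ cong (λ u → (c zero * u + S + + s) + vsum V) ceiling≡ ⟩
    (c zero * (+ a zero * + t₀ + c₀) + S + + s) + vsum V     ≡⟨ l₁ (c zero) (+ a zero) (+ t₀) c₀ S (+ s) (vsum V) ⟩
    c zero * c₀ + + s + (G₀ * + t₀ + (S + vsum V))           ≡⟨ cong (λ u → c zero * c₀ + + s + (G₀ * + t₀ + u)) (∑-coefficients V) ⟩
    c zero * c₀ + + s + (G₀ * + t₀ + S′)                     ≡⟨ cong (λ u → c zero * c₀ + + s + u) (assemble-weight m A Apos P G₀ (z₀ ∷ zs) w inBox) ⟩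
    c zero * c₀ + + s + (Zt + Et + Wt)                       ≡⟨ l₂ (c zero * c₀) (+ s) Zt Et Wt ⟩
    (c zero * c₀ + Zt + Et) + (+ 1 * + s + Wt) ∎
    where
    open ≡-Reasoning
    V = assemble m A (z₀ ∷ zs) w
    t₀ = firstQuotient m A (z₀ ∷ zs) w
    c₀ = ceiling (frac (+ (a zero ℕ.* z₀)) (A zero) (Apos zero))
    S = ∑ (suc m) (λ j → P j * lookup V j)
    S′ = ∑ (suc m) (λ j → (P j + + 1) * lookup V j)
    Zt = ∑ (suc m) (λ j → (P j + + 1) * + lookup (z₀ ∷ zs) j)
    Et = ∑ m (λ j → partialSum m G₀ (increment m A P) (inject₁ j) * ceilingStep m A Apos (z₀ ∷ zs) j)
    Wt = ∑ (suc m) (λ j → partialSum m G₀ (increment m A P) j * + lookup w j)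
    ceiling≡ : ceiling (((+ a zero) /a suc zero) ℚ.* (lookup V zero ℚ./ 1)) ≡ + a zero * + t₀ + c₀
    ceiling≡ = trans (cong (λ λ₂ → ceiling (((+ a zero) /a suc zero) ℚ.* (λ₂ ℚ./ 1))) (lookup-assemble-zero m A z₀ zs w))
                     (ceiling-shift (a zero) (A zero) t₀ z₀ (Apos zero))
    l₁ : ∀ g a t c₀ S s V → (g * (a * t + c₀) + S + s) + V ≡ g * c₀ + s + (g * a * t + (S + V))
    l₁ = solve-∀
    l₂ : ∀ x s Z E W → x + s + (Z + E + W) ≡ (x + Z + E) + (+ 1 * s + W)
    l₂ = solve-∀

  toSolution-Cond : ∀ z s w → Box (suc m) A z → Cond (toSolution (z , s ∷ w))
  toSolution-Cond z s w inBox =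
    ℤ.i≤i+j (lowerBound (assemble m A z w)) (+ s) ,
    from (TailCond⇔Descending m A Apos _) (assemble-descending m A z w inBox)

  Cond⇒toSolution : ∀ v → Cond v → ∃ λ ((z , u) : Coords) → Box (suc m) A z × toSolution (z , u) ≡ v
  Cond⇒toSolution (λ₁ ∷ V) (lowerBound≤λ₁ , tailCond)
    with descending-assembled m A Apos V (to (TailCond⇔Descending m A Apos V) tailCond)
  ... | (z , w) , inBox , refl = (z , s ∷ w) , inBox , cong (_∷ V) (trans (cong (λ x → lowerBound V + x) s≡) (l (lowerBound V) λ₁))
    where
    s = ℤ.∣ lowerBound V - λ₁ ∣
    s≡ : + s ≡ λ₁ - lowerBound V
    s≡ = ℤ.∣-∣-≤ lowerBound≤λ₁
    l : ∀ r x → r + (x - r) ≡ x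
    l = solve-∀

  toSolution-injective : ∀ {z u z′ u′} → Box (suc m) A z → Box (suc m) A z′ →
                         toSolution (z , u) ≡ toSolution (z′ , u′) → (z , u) ≡ (z′ , u′)
  toSolution-injective {z} {s ∷ w} {z′} {s′ ∷ w′} inBox inBox′ eq
    with assemble-injective m A Apos z w z′ w′ inBox inBox′ (cong Data.Vec.tail eq)
  ... | refl , refl =
    cong (λ s → z , s ∷ w) (ℤ.+-injective (x+y≡x+z⇒y≡z (lowerBound (assemble m A z w)) (cong (λ v → lookup v zero) eq)))
    where
    x+y≡x+z⇒y≡z : ∀ x {y z} → x + y ≡ x + z → y ≡ z
    x+y≡x+z⇒y≡z x {y} {z} eq = trans (sym (l x y)) (trans (cong (_- x) eq) (l x z))
      where
      l : ∀ x y → x + y - x ≡ y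
      l = solve-∀

  zeros : Vec ℕ (suc m)
  zeros = replicate (suc m) 0

  expo-zeros : expo zeros ≡ + 0
  expo-zeros = begin
    c zero * ceiling (frac (+ (a zero ℕ.* 0)) (A zero) (Apos zero)) + Zt + Et
      ≡⟨ cong (λ x → c zero * x + Zt + Et) (trans (cong (λ n → ceiling (frac (+ n) (A zero) (Apos zero))) (ℕ.*-zeroʳ (a zero)))
                                                   (ceiling-zero (A zero) (Apos zero))) ⟩
    c zero * + 0 + Zt + Et
      ≡⟨ cong₂ (λ x y → c zero * + 0 + x + y)
           (∑-zero (suc m) _ (λ j → trans (cong (λ u → (P j + + 1) * + u) (lookup-replicate j 0)) (ℤ.*-zeroʳ (P j + + 1))))
           (∑-zero m _ (λ j → trans (cong (partialSum m G₀ (increment m A P) (inject₁ j) *_) step≡0)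
                                     (ℤ.*-zeroʳ (partialSum m G₀ (increment m A P) (inject₁ j))))) ⟩
    c zero * + 0 + + 0 + + 0
      ≡⟨ cong (λ x → x + + 0 + + 0) (ℤ.*-zeroʳ (c zero)) ⟩
    + 0 ∎
    where
    open ≡-Reasoning
    Zt = ∑ (suc m) (λ j → (P j + + 1) * + lookup zeros j)
    Et = ∑ m (λ j → partialSum m G₀ (increment m A P) (inject₁ j) * ceilingStep m A Apos zeros j)
    step≡0 : ∀ {j} → ceilingStep m A Apos zeros j ≡ + 0
    step≡0 {j} =
      trans (cong₂ (λ u v → ceiling (frac (+ u) (A (suc j)) (Apos (suc j)) ℚ.- frac (+ v) (A (inject₁ j)) (Apos (inject₁ j))))
                   (lookup-replicate (suc j) 0) (lookup-replicate (inject₁ j) 0))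
            (ceiling-carry (A (inject₁ j)) (A (suc j)) 0 0 (Apos (inject₁ j)) (Apos (suc j))
                           (ℕ.>-nonZero⁻¹ _ {{Apos (inject₁ j)}}) (ℕ.>-nonZero⁻¹ _ {{Apos (suc j)}}))

  module _ (λ₁-nonneg : ∀ v → Cond v → + 0 ℤ.≤ lookup v zero) where

    b-positive : ∀ j → + 1 ℤ.≤ b (suc j)
    b-positive j = begin
      + 1                     ≤⟨ ℤ.+≤+ (ℕ.≤-trans (ℕ.*-mono-≤ 1≤A₀ 1≤t₀) (ℕ.m≤m+n _ 0)) ⟩
      + (A zero ℕ.* t₀ ℕ.+ 0) ≡⟨ lookup-assemble-zero m A 0 (replicate m 0) w ⟨
      lookup V zero           ≤⟨ ℤ.i≤i+j (lookup V zero) (+ proj₁ (vsum-assemble m A zeros w)) ⟩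
      lookup V zero + + proj₁ (vsum-assemble m A zeros w) ≡⟨ proj₂ (vsum-assemble m A zeros w) ⟨
      vsum V                  ≡⟨ ℤ.+-identityˡ (vsum V) ⟨
      + 0 + vsum V            ≤⟨ ℤ.+-monoˡ-≤ (vsum V) (λ₁-nonneg v (toSolution-Cond zeros 0 w inBox)) ⟩
      vsum v                  ≡⟨ vsum-toSolution zeros 0 w inBox ⟩
      expo zeros + ∑ (2 ℕ.+ m) (λ i → b i * + lookup (0 ∷ w) i)
        ≡⟨ cong₂ _+_ expo-zeros (∑-unitVec (2 ℕ.+ m) b (suc j)) ⟩
      + 0 + b (suc j)         ≡⟨ ℤ.+-identityˡ (b (suc j)) ⟩
      b (suc j) ∎
      where
      open ℤ.≤-Reasoning
      w = unitVec (suc m) j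
      v = toSolution (zeros , 0 ∷ w)
      V = assemble m A zeros w
      t₀ = firstQuotient m A zeros w
      inBox = zeros-inBox (suc m) A Apos
      1≤t₀ : 1 ℕ.≤ t₀
      1≤t₀ = subst (ℕ._≤ t₀) (lookup-unitVec (suc m) j) (≤-firstQuotient m A zeros w j)
      1≤A₀ : 1 ℕ.≤ A zero
      1≤A₀ = ℕ.>-nonZero⁻¹ (A zero) {{Apos zero}}

    d : Fin (2 ℕ.+ m) → ℕ
    d i = ℤ.∣ b i ∣ ℕ.∸ 1

    b≡1+d : ∀ i → b i ≡ + suc (d i)
    b≡1+d zero    = refl
    b≡1+d (suc j) = positive (b-positive j)
      where
      positive : ∀ {x} → + 1 ℤ.≤ x → x ≡ + suc (ℤ.∣ x ∣ ℕ.∸ 1)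
      positive {+ suc _} (ℤ.+≤+ (ℕ.s≤s _)) = refl

    vsum-toSolution-weight : ∀ z u → Box (suc m) A z → vsum (toSolution (z , u)) ≡ expo z + + weight (2 ℕ.+ m) d u
    vsum-toSolution-weight z (s ∷ w) inBox =
      trans (vsum-toSolution z s w inBox) (cong (λ x → expo z + x) (sym (weight≡∑ (2 ℕ.+ m) d b b≡1+d (s ∷ w))))

    Slack : ℤ → Vec ℕ (suc m) → Vec ℕ (2 ℕ.+ m) → Set
    Slack n z u = + weight (2 ℕ.+ m) d u ≡ n - expo z

    Sol⇔ : ∀ n v → (∃ λ x → InBox (suc m) A (Slack n) x × toSolution x ≡ v) ⇔ Sol n v
    Sol⇔ n v = mk⇔ (λ { ((z , s ∷ w) , (inBox , slack) , refl) → toSolution-Cond z s w inBox , vsum≡n z (s ∷ w) inBox slack })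
                   (λ (cond , vsum≡n) → let ((z , u) , inBox , eq) = Cond⇒toSolution v cond in
                      (z , u) , (inBox , slack z u inBox (trans (cong vsum eq) vsum≡n)) , eq)
      where
      l₁ : ∀ e n → e + (n - e) ≡ n
      l₁ = solve-∀
      l₂ : ∀ e w → e + w - e ≡ w
      l₂ = solve-∀
      vsum≡n : ∀ z u → Box (suc m) A z → Slack n z u → vsum (toSolution (z , u)) ≡ n
      vsum≡n z u inBox slack = trans (vsum-toSolution-weight z u inBox) (trans (cong (λ x → expo z + x) slack) (l₁ (expo z) n))
      slack : ∀ z u → Box (suc m) A z → vsum (toSolution (z , u)) ≡ n → Slack n z u
      slack z u inBox vsum≡n = trans (sym (l₂ (expo z) _)) (cong (_- expo z) (trans (sym (vsum-toSolution-weight z u inBox)) vsum≡n))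

    count : ℤ → ℕ
    count n = sumBoxℕ (suc m) A (λ z → repsℤ (2 ℕ.+ m) d (n - expo z))

    HasCount-Sol : ∀ n → HasCount (Sol n) (count n)
    HasCount-Sol n =
      HasCount-resp (Sol⇔ n)
        (HasCount-image toSolution (HasCount-box (suc m) A (Slack n) _ (λ z → HasCount-repsℤ (2 ℕ.+ m) d (n - expo z)))
                        (λ (inBox , _) (inBox′ , _) → toSolution-injective inBox inBox′))

    generatingFunction : ∀ n → mulDen (2 ℕ.+ m) b (λ t → + count t) n ≡ numer n
    generatingFunction n = begin
      mulDen (2 ℕ.+ m) b (λ t → + count t) n
        ≡⟨ mulDen-cong-parts (2 ℕ.+ m) b b′ _ b≡1+d n ⟩
      mulDen (2 ℕ.+ m) b′ (λ t → + count t) n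
        ≡⟨ mulDen-cong (2 ℕ.+ m) b′ _ _ (λ t → sumBoxℕ-sumBox (suc m) A (λ z → repsℤ (2 ℕ.+ m) d (t - expo z))) n ⟩
      mulDen (2 ℕ.+ m) b′ (λ t → sumBox (suc m) A (λ z → + repsℤ (2 ℕ.+ m) d (t - expo z))) n
        ≡⟨ mulDen-sumBox (2 ℕ.+ m) b′ (suc m) A (λ z t → + repsℤ (2 ℕ.+ m) d (t - expo z)) n ⟩
      sumBox (suc m) A (λ z → mulDen (2 ℕ.+ m) b′ (λ t → + repsℤ (2 ℕ.+ m) d (t - expo z)) n)
        ≡⟨ sumBox-cong (suc m) A _ _ (λ z → mulDen-repsℤ (2 ℕ.+ m) d (expo z) n) ⟩
      numer n ∎
      where
      open ≡-Reasoning
      b′ : Fin (2 ℕ.+ m) → ℤ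
      b′ i = + suc (d i)


open import Data.Nat using (ℕ; NonZero; _+_)
open import Data.Integer using (ℤ; +_)
open import Data.Fin using (Fin; zero)
open import Data.Vec using (Vec; lookup)
open import Data.Product using (Σ; _×_; _,_)
open import Relation.Binary.PropositionalEquality using (_≡_)

corollary5 : (m : ℕ) (a : Fin (2 + m) → ℕ) (apos : ∀ i → NonZero (a i)) (c : Fin (2 + m) → ℤ)
    → (∀ (v : Vec ℤ (2 + m)) → Setup.Cond m a apos c v → + 0 Data.Integer.≤ lookup v zero)
    → Σ (ℤ → ℕ) λ F
        → (∀ n → HasCount (Setup.Sol m a apos c n) (F n))
        × (∀ n → mulDen (2 + m) (Setup.b m a apos c) (λ t → + F t) n ≡ Setup.numer m a apos c n)
corollary5 m a apos c λ₁-nonneg = count λ₁-nonneg , HasCount-Sol λ₁-nonneg , generatingFunction λ₁-nonneg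
  where open Corollary5Proof m a apos c
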